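{- Let $\omega\in\Omega$ and let $\mathcal P^{\mathbb 1(\omega)}$ be the set of partitions (finite multisets) with parts in $E_1$ such that, with $f_u$ the multiplicity of $u\in E_1$ and fictitious frequencies $f_u=\chi(u=\mathbb 1(\omega))$ for $u\in E_{ -1}\setminus E_1$, one has $f_{e_0}+\dots+f_{e_m}\le1$ for all paths $(e_0,\dots,e_m)$ in $E_{ -1}$. Then $$\sum_{\pi\in\mathcal P^{\mathbb 1(\omega)}}q^{|\pi|}=\mathbb 1\Bigl(c(\omega)^{ -1}q^{ -|\omega|}\sum_{\pi\in\mathcal P^{\omega}_\rho}C(\pi)q^{|\pi|}\Bigr).$$
   Context: $m\ge1$, $\mathcal O=\{1<\dots<m\}$, $\overline x=m+1-x$, $\chi$ = truth value. Primary-coloured integers $k_{c_j}$ ($k\in\mathbb Z$, $j\in\mathcal O$); secondary colours $c_{x,y}=c_xc_y$ ($x\le y$), secondary-coloured integers $k_{c_{x,y}}$ form $\mathbb Z_{\mathcal S}$, with $\eta(2k_{c_{x,y}})=k_{c_y}$, $\zeta(2k_{c_{x,y}})=k_{c_x}$, $\eta((2k+1)_{c_{x,y}})=(k+1)_{c_x}$, $\zeta((2k+1)_{c_{x,y}})=k_{c_y}$. $\rho(c_{x',y'},c_{x,y})=\chi(x\ge x')+\chi(y\ge y')-\chi(y\ge y'>x\ge x')$, $k_c\gg_\rho l_d$ iff $k-l\ge\rho(c,d)$. $\omega_0=(-1)_{c_{m,m}}$, $\omega_i=0_{c_{i,\overline{i+1}}}$ ($1\le i\le\lfloor m/2\rfloor$),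 $\Omega=\{\omega_u:0\le u\le\lfloor m/2\rfloor\}\sqcup\{0_{c_{u,\overline u}}:1\le u\le\lceil m/2\rceil\}$. $\mathcal P^\omega_\rho$: sequences $(\pi_0,\dots,\pi_{s-1},\omega)$ in $\mathbb Z_{\mathcal S}$ with consecutive parts related by $\gg_\rho$; $|\pi|$ = sum of sizes, $C(\pi)$ = product of colours of all parts. $\mathbb 1(k_{c_j})=km-\frac{m+1}{2}+j$ for primary-coloured integers; for $e\in\mathbb Z_{\mathcal S}$, $\mathbb 1(e)$ is the symbol $l_d$ with size $l=\mathbb 1(\eta(e))+\mathbb 1(\zeta(e))$ and subscript $d=\mathbb 1(\eta(e))-\mathbb 1(\zeta(e))\in\{0,\dots,m\}$. For $k\in\mathbb Z\cup\{ -\infty\}$, $E_k=\{l_d:l\ge k,\ d\in\{0,\dots,m\},\ l-d\equiv m+1\pmod 2\}$. A path in $E_k$ is a sequence $((l^{(0)})_0,\dots,(l^{(m)})_m)$ of elements of $E_k$ with $l^{(j+1)}=l^{(j)}\pm1$. The size of a partition with parts in $E_1$ is the sum of the sizes $l$. On generating functions, $\mathbb 1$ is the substitution $q\mapsto q^m$, $c_j\mapsto q^{j-\frac{m+1}{2}}$, under which $c(e)q^{|e|}\mapsto q^{\text{size of }\mathbb 1(e)}$ for each $e\in\mathbb Z_{\mathcal S}$. -}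

module Defs where

open import Data.Bool.Base using (Bool; true; false; if_then_else_; _∧_)
open import Data.Nat.Base as ℕ using (ℕ; zero; suc; _≤ᵇ_; _<ᵇ_; ⌊_/2⌋; ⌈_/2⌉)
open import Data.Integer.Base as ℤ using (ℤ; +_; -[1+_]; _/ℕ_; _%ℕ_; ∣_∣)
open import Data.Integer.Divisibility as ℤ∣ using ()
open import Data.Fin.Base as Fin using (Fin; toℕ; inject₁)
open import Data.List.Base using (List; []; _∷_; _++_; map; foldr; length; filter; allFin)
open import Data.List.Relation.Unary.All using (All)
open import Data.List.Relation.Unary.Linked using (Linked)
open import Data.Product.Base using (_×_; _,_; proj₁; proj₂)
open import Data.Product.Properties using (≡-dec)
open import Data.Sum.Base using (_⊎_)
open import Data.Refinement using (Refinement)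
open import Relation.Nullary.Decidable using (Dec; yes; no; does)
open import Relation.Binary.PropositionalEquality using (_≡_)
import Data.Nat.Properties as ℕP
import Data.Integer.Properties as ℤP

χ : Bool → ℕ
χ true  = 1
χ false = 0

sumℤ : List ℤ → ℤ
sumℤ = foldr ℤ._+_ (+ 0)

sumℕ : List ℕ → ℕ
sumℕ = foldr ℕ._+_ 0

-- Primary-coloured integers k_{c_j} : pairs (k , j), 1 ≤ j ≤ m.
-- Secondary-coloured integers k_{c_{x,y}} : records (k , x , y),
-- with 1 ≤ x ≤ y ≤ m (validity predicate ValidSC).

Prim : Set
Prim = ℤ × ℕ

record SC : Set where
  constructor sc
  field
    num : ℤ
    x   : ℕ
    y   : ℕ
open SC public

ValidSC : ℕ → SC → Set
ValidSC m e = (1 ℕ.≤ x e) × (x e ℕ.≤ y e) × (y e ℕ.≤ m)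

half : SC → ℤ
half e = num e /ℕ 2

isOdd : SC → Bool
isOdd e = 1 ≤ᵇ (num e %ℕ 2)

η : SC → Prim
η e = if isOdd e then (half e ℤ.+ + 1 , x e) else (half e , y e)

ζ : SC → Prim
ζ e = if isOdd e then (half e , y e) else (half e , x e)

-- Symbols l_d : pairs (l , d) with l ∈ ℤ, d ∈ ℕ.
Sym : Set
Sym = ℤ × ℕ

-- TWICE the value 𝟙(k_{c_j}) = k m − (m+1)/2 + j, i.e. 2km − (m+1) + 2j
-- (doubled to stay inside ℤ, as 𝟙(k_{c_j}) may be a half-integer).
two𝟙P : ℕ → Prim → ℤ
two𝟙P m (k , j) = (+ 2) ℤ.* k ℤ.* (+ m) ℤ.- (+ suc m) ℤ.+ (+ 2) ℤ.* (+ j)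

-- 𝟙(e) = l_d with l = 𝟙(η e) + 𝟙(ζ e), d = 𝟙(η e) − 𝟙(ζ e)
𝟙 : ℕ → SC → Sym
𝟙 m e = ((A ℤ.+ B) /ℕ 2) , ∣ (A ℤ.- B) /ℕ 2 ∣
  where
  A = two𝟙P m (η e)
  B = two𝟙P m (ζ e)

ρ : (x' y' x y : ℕ) → ℤ
ρ x' y' x y =
  + χ (x' ≤ᵇ x) ℤ.+ + χ (y' ≤ᵇ y) ℤ.- + χ ((y' ≤ᵇ y) ∧ (x <ᵇ y') ∧ (x' ≤ᵇ x))

_≫_ : SC → SC → Set
a ≫ b = ρ (x a) (y a) (x b) (y b) ℤ.≤ num a ℤ.- num b

data InΩ (m : ℕ) : SC → Set where
  ω-zero : InΩ m (sc -[1+ 0 ] m m)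
  ω-pos  : ∀ i → 1 ℕ.≤ i → i ℕ.≤ ⌊ m /2⌋ → InΩ m (sc (+ 0) i (m ℕ.∸ i))
  ω-bar  : ∀ u → 1 ℕ.≤ u → u ℕ.≤ ⌈ m /2⌉ → InΩ m (sc (+ 0) u (suc m ℕ.∸ u))

-- P^ω_ρ : sequences (π₀, …, π_{s−1}, ω); we store the list (π₀ … π_{s−1}),
-- ω being appended.  Weight after dividing by c(ω) q^{|ω|} and applying
-- the substitution 𝟙: Σ_{i<s} size(𝟙(π_i)).

InPρ : ℕ → SC → List SC → Set
InPρ m ω π = All (ValidSC m) π × Linked _≫_ (π ++ ω ∷ [])

weight𝟙 : ℕ → List SC → ℤ
weight𝟙 m π = sumℤ (map (λ e → proj₁ (𝟙 m e)) π)

RHS : ℕ → SC → ℤ → Set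
RHS m ω n = Refinement (List SC) (λ π → InPρ m ω π × weight𝟙 m π ≡ n)

InE : ℕ → ℤ → Sym → Set
InE m k (l , d) = (k ℤ.≤ l) × (d ℕ.≤ m) × ((+ 2) ℤ∣.∣ (l ℤ.- + d ℤ.- + suc m))

record Path (m : ℕ) : Set where
  field
    L      : Fin (suc m) → ℤ
    inE    : ∀ j → InE m -[1+ 0 ] (L j , toℕ j)
    steps  : ∀ (j : Fin m) →
             (L (Fin.suc j) ≡ L (inject₁ j) ℤ.+ + 1) ⊎ (L (Fin.suc j) ≡ L (inject₁ j) ℤ.- + 1)
open Path public

_≟S_ : (u v : Sym) → Dec (u ≡ v)
_≟S_ = ≡-dec ℤP._≟_ ℕP._≟_

count : Sym → List Sym → ℕ
count u π = length (filter (λ v → v ≟S u) π)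

freq : ℕ → SC → List Sym → Sym → ℕ
freq m ω π u with (+ 1) ℤP.≤? proj₁ u
... | yes _ = count u π
... | no  _ = χ (does (u ≟S 𝟙 m ω))

-- partitions (finite multisets) with parts in E₁, represented canonically
-- as lists sorted in weakly decreasing lexicographic order on (l , d)
_≽_ : Sym → Sym → Set
(l , d) ≽ (l' , d') = (l' ℤ.< l) ⊎ ((l ≡ l') × (d' ℕ.≤ d))

PathCond : ℕ → SC → List Sym → Set
PathCond m ω π =
  (p : Path m) → sumℕ (map (λ j → freq m ω π (L p j , toℕ j)) (allFin (suc m))) ℕ.≤ 1

InP𝟙 : ℕ → SC → List Sym → Set
InP𝟙 m ω π = All (InE m (+ 1)) π × Linked _≽_ π × PathCond m ω π

sizeP : List Sym → ℤ
sizeP π = sumℤ (map proj₁ π)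

LHS : ℕ → SC → ℤ → Set
LHS m ω n = Refinement (List Sym) (λ π → InP𝟙 m ω π × sizeP π ≡ n)

module Submission where

-- Write rank(k_{c_j}) = k m + j, so that 𝟙(e) = l_d with l = rank η(e) + rank ζ(e) − (m + 1)
-- and d = rank η(e) − rank ζ(e).  The map e ↦ (rank ζ(e), rank η(e)) is a bijection from
-- secondary-coloured integers onto pairs u ≤ v ≤ u + m, hence 𝟙 is a bijection onto the
-- symbols l_d with 0 ≤ d ≤ m and l ≡ d + m + 1 (mod 2).  A case analysis on parities shows
-- that a ≫_ρ b holds exactly when both ranks of a exceed those of b, which for the images
-- says ∣ d_a − d_b ∣ < l_a − l_b: 𝟙(b) lies strictly inside the downward cone of 𝟙(a).
-- So 𝟙 maps 𝒫^ω_ρ onto the lists of symbols that, followed by 𝟙(ω), form a chain in this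
-- cone order.  For sorted partitions with parts in E₁ that is the path condition: a path
-- has slopes ±1 and meets no two elements of such a chain, while two consecutive parts
-- (or a repeated one) not in cone position both lie on the lower envelope of the V-shaped
-- paths through them, which then carries total frequency at least 2.

open import Defs

open import Algebra.Bundles using (AbelianGroup)
open import Data.Bool.Base using (true; false; if_then_else_; _∧_)
open import Data.Empty using (⊥-elim)
open import Data.Fin.Base as Fin using (Fin; toℕ; inject₁; fromℕ<)
import Data.Fin.Properties as FinP
open import Data.Integer.Base as ℤ
  using (ℤ; +_; -[1+_]; _/ℕ_; _%ℕ_; ∣_∣; _+_; _-_; _*_; _⊓_; _≤_; _<_; +≤+; +<+; -≤+; -<+)
open import Data.Integer.DivMod using (a≡a%ℕn+[a/ℕn]*n; n%ℕd<d)
import Data.Integer.Divisibility as ℤ∣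
import Data.Integer.Properties as ℤP
open import Data.Integer.Tactic.RingSolver using (solve-∀)
open import Data.Irrelevant as Irr using ([_])
open import Data.List.Base using (List; []; _∷_; _++_; _∷ʳ_; map; length; tabulate; allFin)
open import Data.List.Membership.Propositional using (_∈_)
import Data.List.Properties as LP
open import Data.List.Relation.Unary.All as All using (All; []; _∷_)
import Data.List.Relation.Unary.All.Properties as AllP
open import Data.List.Relation.Unary.AllPairs using (AllPairs; []; _∷_)
open import Data.List.Relation.Unary.Any using (here; there)
import Data.List.Relation.Unary.Any.Properties as AnyP
open import Data.List.Relation.Unary.Linked as Linked using (Linked; []; [-]; _∷_)
open import Data.List.Relation.Unary.Linked.Properties using (Linked⇒AllPairs; AllPairs⇒Linked)
open import Data.Nat.Base as ℕ using (ℕ; zero; suc; NonZero; _≤ᵇ_)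
import Data.Nat.Divisibility as ℕ∣
open import Data.Nat.Divisibility.Core using (divides)
import Data.Nat.Properties as ℕP
open import Data.Product.Base using (_×_; _,_; proj₁; proj₂; Σ; swap)
open import Data.Product.Function.NonDependent.Propositional using (_×-⇔_)
open import Data.Refinement using (_,_; value-injective)
open import Data.Sum.Base using (_⊎_; inj₁; inj₂)
open import Function.Base using (_∘_)
open import Function.Bundles using (_⇔_; _↔_; mk⇔; mk↔ₛ′; Equivalence)
open import Function.Construct.Composition using (_⇔-∘_)
open import Function.Construct.Symmetry using (⇔-sym)
open import Relation.Binary.Definitions using (tri<; tri≈; tri>)
open import Relation.Binary.PropositionalEquality
open import Relation.Nullary using (¬_; Dec; yes; no; does)
open import Relation.Nullary.Decidable using (_×-dec_; recompute)
open import Relation.Nullary.Reflects using (Reflects; ofʸ; ofⁿ)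

open import Algebra.Properties.Group (AbelianGroup.group ℤP.+-0-abelianGroup) using (∙-cancelʳ)
open Equivalence using (to; from)

≤-by : ∀ {a b} (c : ℤ) → + 0 ≤ c → b ≡ a + c → a ≤ b
≤-by {a} c 0≤c refl = subst (_≤ a + c) (ℤP.+-identityʳ a) (ℤP.+-monoʳ-≤ a 0≤c)

<-by : ∀ {a b} (c : ℤ) → + 0 < c → b ≡ a + c → a < b
<-by {a} c 0<c refl = subst (_< a + c) (ℤP.+-identityʳ a) (ℤP.+-monoʳ-< a 0<c)

i<j⇒0<j-i : ∀ {i j} → i < j → + 0 < j - i
i<j⇒0<j-i {i} {j} i<j = subst (_< j - i) (ℤP.+-inverseʳ i) (ℤP.+-monoˡ-< (ℤ.- i) i<j)

0<j-i⇒i<j : ∀ {i j} → + 0 < j - i → i < j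
0<j-i⇒i<j {i} {j} p = <-by (j - i) p (eq i j)
  where
  eq : ∀ i j → j ≡ i + (j - i)
  eq = solve-∀

i<j⇔0<j-i : ∀ {i j} → (i < j) ⇔ (+ 0 < j - i)
i<j⇔0<j-i = mk⇔ i<j⇒0<j-i 0<j-i⇒i<j

m<n⇔0<n-m : ∀ m n → (m ℕ.< n) ⇔ (+ 0 < + n - + m)
m<n⇔0<n-m m n = mk⇔ (λ m<n → i<j⇒0<j-i (+<+ m<n)) (λ p → ℤP.drop‿+<+ (0<j-i⇒i<j p))

i<j⇒i+1≤j : ∀ {i j} → i < j → i + + 1 ≤ j
i<j⇒i+1≤j {i} {j} i<j = subst (_≤ j) (ℤP.+-comm (+ 1) i) (ℤP.i<j⇒suc[i]≤j i<j)

compare₃ : ∀ i j → (i ≤ j - + 1) ⊎ (i ≡ j) ⊎ (j + + 1 ≤ i)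
compare₃ i j with ℤP.<-cmp i j
... | tri< i<j _ _ = inj₁ (subst (i ≤_) (ℤP.+-comm (ℤ.- + 1) j) (ℤP.i<j⇒i≤pred[j] i<j))
... | tri≈ _ i≡j _ = inj₂ (inj₁ i≡j)
... | tri> _ _ j<i = inj₂ (inj₂ (i<j⇒i+1≤j j<i))

module _ (n : ℕ) .{{_ : NonZero n}} where

  private
    between : ∀ a q r → r ℕ.< n → a ≡ + r + q * + n → (q * + n ≤ a) × (a < (q + + 1) * + n)
    between a q r r<n refl =
      ≤-by (+ r) (+≤+ ℕ.z≤n) (ℤP.+-comm (+ r) (q * + n)) ,
      <-by (+ n - + r) (i<j⇒0<j-i (+<+ r<n)) (eq q (+ n) (+ r))
      where
      eq : ∀ q n r → (q + + 1) * n ≡ (r + q * n) + (n - r)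
      eq = solve-∀

    quotient-≤ : ∀ a q r q′ r′ → r ℕ.< n → r′ ℕ.< n →
                 a ≡ + r + q * + n → a ≡ + r′ + q′ * + n → q ≤ q′
    quotient-≤ a q r q′ r′ r<n r′<n a≡ a≡′ =
      subst (q ≤_) (eq q′) (ℤP.i<j⇒i≤pred[j] q<q′+1)
      where
      q<q′+1 : q < q′ + + 1
      q<q′+1 = ℤP.*-cancelʳ-<-nonNeg (+ n)
        (ℤP.≤-<-trans (proj₁ (between a q r r<n a≡)) (proj₂ (between a q′ r′ r′<n a≡′)))
      eq : ∀ q → ℤ.- (+ 1) + (q + + 1) ≡ q
      eq = solve-∀

  /ℕ-%ℕ-unique : ∀ a q r → r ℕ.< n → a ≡ + r + q * + n → (a /ℕ n ≡ q) × (a %ℕ n ≡ r)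
  /ℕ-%ℕ-unique a q r r<n a≡ = q≡ , ℤP.+-injective (∙-cancelʳ ((a /ℕ n) * + n) _ _ (begin
      + (a %ℕ n) + (a /ℕ n) * + n ≡⟨ divmod ⟨
      a                            ≡⟨ a≡ ⟩
      + r + q * + n                ≡⟨ cong (λ z → + r + z * + n) q≡ ⟨
      + r + (a /ℕ n) * + n         ∎))
    where
    open ≡-Reasoning
    divmod = a≡a%ℕn+[a/ℕn]*n a n
    q≡ : a /ℕ n ≡ q
    q≡ = ℤP.≤-antisym (quotient-≤ a _ _ q r (n%ℕd<d a n) r<n divmod a≡)
                      (quotient-≤ a q r _ _ r<n (n%ℕd<d a n) a≡ divmod)

2*i/ℕ2≡i : ∀ i → (+ 2 * i) /ℕ 2 ≡ i
2*i/ℕ2≡i i = proj₁ (/ℕ-%ℕ-unique 2 (+ 2 * i) i 0 (ℕ.s≤s ℕ.z≤n) (eq i))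
  where
  eq : ∀ i → + 2 * i ≡ + 0 + i * + 2
  eq = solve-∀

-- 𝟙(k_{c_j}) is rank m (k , j) − (m + 1)/2.
rank : ℕ → Prim → ℤ
rank m (k , j) = k * + m + + j

ζ-rank η-rank : ℕ → SC → ℤ
ζ-rank m e = rank m (ζ e)
η-rank m e = rank m (η e)

two𝟙P≡ : ∀ m p → two𝟙P m p ≡ + 2 * rank m p - + suc m
two𝟙P≡ m (k , j) = eq k (+ m) (+ j) (+ suc m)
  where
  eq : ∀ k m j s → + 2 * k * m - s + + 2 * j ≡ + 2 * (k * m + j) - s
  eq = solve-∀

𝟙≡ranks : ∀ m e → 𝟙 m e ≡ (η-rank m e + ζ-rank m e - + suc m , ∣ η-rank m e - ζ-rank m e ∣)
𝟙≡ranks m e = cong₂ _,_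
  (trans (cong (_/ℕ 2) (begin
    two𝟙P m (η e) + two𝟙P m (ζ e)  ≡⟨ cong₂ _+_ (two𝟙P≡ m (η e)) (two𝟙P≡ m (ζ e)) ⟩
    (+ 2 * η̂ - s) + (+ 2 * ζ̂ - s)  ≡⟨ sum-eq η̂ ζ̂ s ⟩
    + 2 * (η̂ + ζ̂ - s)              ∎)) (2*i/ℕ2≡i (η̂ + ζ̂ - s)))
  (cong ∣_∣ (trans (cong (_/ℕ 2) (begin
    two𝟙P m (η e) - two𝟙P m (ζ e)  ≡⟨ cong₂ _-_ (two𝟙P≡ m (η e)) (two𝟙P≡ m (ζ e)) ⟩
    (+ 2 * η̂ - s) - (+ 2 * ζ̂ - s)  ≡⟨ diff-eq η̂ ζ̂ s ⟩
    + 2 * (η̂ - ζ̂)                  ∎)) (2*i/ℕ2≡i (η̂ - ζ̂))))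
  where
  open ≡-Reasoning
  η̂ = η-rank m e
  ζ̂ = ζ-rank m e
  s = + suc m
  sum-eq : ∀ a b s → (+ 2 * a - s) + (+ 2 * b - s) ≡ + 2 * (a + b - s)
  sum-eq = solve-∀
  diff-eq : ∀ a b s → (+ 2 * a - s) - (+ 2 * b - s) ≡ + 2 * (a - b)
  diff-eq = solve-∀

data ParityView (m : ℕ) (e : SC) : Set where
  even : ∀ h → num e ≡ h * + 2 →
         ζ-rank m e ≡ h * + m + + x e → η-rank m e ≡ h * + m + + y e → ParityView m e
  odd  : ∀ h → num e ≡ h * + 2 + + 1 →
         ζ-rank m e ≡ h * + m + + y e → η-rank m e ≡ (h + + 1) * + m + + x e → ParityView m e

private
  ranks-at : ∀ m e {b h} → isOdd e ≡ b → half e ≡ h →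
             (ζ-rank m e ≡ rank m (if b then (h , y e) else (h , x e))) ×
             (η-rank m e ≡ rank m (if b then (h + + 1 , x e) else (h , y e)))
  ranks-at m e refl refl = refl , refl

parityView : ∀ m e → ParityView m e
parityView m e = view (num e %ℕ 2) refl (n%ℕd<d (num e) 2)
  where
  divmod = a≡a%ℕn+[a/ℕn]*n (num e) 2
  2h = half e * + 2
  view : ∀ r → num e %ℕ 2 ≡ r → r ℕ.< 2 → ParityView m e
  view 0 r≡ _ = even (half e)
    (trans divmod (trans (cong (λ r → + r + 2h) r≡) (ℤP.+-identityˡ 2h)))
    (proj₁ ranks) (proj₂ ranks)
    where ranks = ranks-at m e (cong (1 ≤ᵇ_) r≡) refl
  view 1 r≡ _ = odd (half e)
    (trans divmod (trans (cong (λ r → + r + 2h) r≡) (ℤP.+-comm (+ 1) 2h)))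
    (proj₁ ranks) (proj₂ ranks)
    where ranks = ranks-at m e (cong (1 ≤ᵇ_) r≡) refl
  view (suc (suc _)) _ (ℕ.s≤s (ℕ.s≤s ()))

module _ (m : ℕ) (k : ℤ) (x y : ℕ) where

  ranks-of-even : (ζ-rank m (sc (k * + 2) x y) ≡ k * + m + + x) ×
                  (η-rank m (sc (k * + 2) x y) ≡ k * + m + + y)
  ranks-of-even
    with /ℕ-%ℕ-unique 2 (k * + 2) k 0 (ℕ.s≤s ℕ.z≤n) (sym (ℤP.+-identityˡ (k * + 2)))
  ... | half≡ , rem≡ = ranks-at m (sc (k * + 2) x y) (cong (1 ≤ᵇ_) rem≡) half≡

  ranks-of-odd : (ζ-rank m (sc (k * + 2 + + 1) x y) ≡ k * + m + + y) ×
                 (η-rank m (sc (k * + 2 + + 1) x y) ≡ (k + + 1) * + m + + x)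
  ranks-of-odd
    with /ℕ-%ℕ-unique 2 (k * + 2 + + 1) k 1 (ℕ.s≤s (ℕ.s≤s ℕ.z≤n)) (ℤP.+-comm (k * + 2) (+ 1))
  ... | half≡ , rem≡ = ranks-at m (sc (k * + 2 + + 1) x y) (cong (1 ≤ᵇ_) rem≡) half≡

rank-gap : ∀ {m e} → ValidSC m e →
           (+ 0 ≤ η-rank m e - ζ-rank m e) × (η-rank m e - ζ-rank m e ≤ + m)
rank-gap {m} {e} (_ , x≤y , y≤m) with parityView m e
... | even h _ ζ≡ η≡ =
  subst (+ 0 ≤_) (sym gap) (ℤP.i≤j⇒0≤j-i (+≤+ x≤y)) ,
  subst (_≤ + m) (sym gap) (ℤP.i≤j⇒i-k≤j (+ x e) (+≤+ y≤m))
  where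
  gap : η-rank m e - ζ-rank m e ≡ + y e - + x e
  gap = trans (cong₂ _-_ η≡ ζ≡) (eq h (+ m) (+ x e) (+ y e))
    where
    eq : ∀ h m x y → (h * m + y) - (h * m + x) ≡ y - x
    eq = solve-∀
... | odd h _ ζ≡ η≡ =
  subst (+ 0 ≤_) (sym gap) (ℤP.+-mono-≤ (+≤+ ℕ.z≤n) (ℤP.i≤j⇒0≤j-i (+≤+ y≤m))) ,
  subst (_≤ + m) (sym gap)
    (≤-by (+ y e - + x e) (ℤP.i≤j⇒0≤j-i (+≤+ x≤y)) (eq′ (+ x e) (+ y e) (+ m)))
  where
  gap : η-rank m e - ζ-rank m e ≡ + x e + (+ m - + y e)
  gap = trans (cong₂ _-_ η≡ ζ≡) (eq h (+ m) (+ x e) (+ y e))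
    where
    eq : ∀ h m x y → ((h + + 1) * m + x) - (h * m + y) ≡ x + (m - y)
    eq = solve-∀
  eq′ : ∀ x y m → m ≡ (x + (m - y)) + (y - x)
  eq′ = solve-∀

record ρSpec (r : ℤ) (xa ya xb yb : ℕ) : Set where
  field
    ρ≥0  : + 0 ≤ r
    ρ≤2  : r ≤ + 2
    ρ≤0⇔ : (r ≤ + 0) ⇔ ((xb ℕ.< xa) × (yb ℕ.< ya))
    ρ≤1⇔ : (r ≤ + 1) ⇔ (xb ℕ.< ya)

private
  ρ-byCases : ∀ {xa ya xb yb c₁ c₂ c₃} →
              Reflects (xa ℕ.≤ xb) c₁ → Reflects (ya ℕ.≤ yb) c₂ → Reflects (xb ℕ.< ya) c₃ →
              xa ℕ.≤ ya → xb ℕ.≤ yb →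
              ρSpec (+ χ c₁ + + χ c₂ - + χ (c₂ ∧ c₃ ∧ c₁)) xa ya xb yb
  ρ-byCases (ofʸ p₁) (ofʸ p₂) (ofʸ p₃) _ _ = record
    { ρ≥0 = +≤+ ℕ.z≤n ; ρ≤2 = +≤+ (ℕ.s≤s ℕ.z≤n)
    ; ρ≤0⇔ = mk⇔ (λ { (+≤+ ()) }) (λ q → ⊥-elim (ℕP.<⇒≱ (proj₁ q) p₁))
    ; ρ≤1⇔ = mk⇔ (λ _ → p₃) (λ _ → ℤP.≤-refl) }
  ρ-byCases (ofʸ p₁) (ofʸ p₂) (ofⁿ p₃) _ _ = record
    { ρ≥0 = +≤+ ℕ.z≤n ; ρ≤2 = ℤP.≤-refl
    ; ρ≤0⇔ = mk⇔ (λ { (+≤+ ()) }) (λ q → ⊥-elim (ℕP.<⇒≱ (proj₁ q) p₁))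
    ; ρ≤1⇔ = mk⇔ (λ { (+≤+ (ℕ.s≤s ())) }) (λ q → ⊥-elim (p₃ q)) }
  ρ-byCases (ofʸ p₁) (ofⁿ p₂) (ofʸ p₃) _ _ = record
    { ρ≥0 = +≤+ ℕ.z≤n ; ρ≤2 = +≤+ (ℕ.s≤s ℕ.z≤n)
    ; ρ≤0⇔ = mk⇔ (λ { (+≤+ ()) }) (λ q → ⊥-elim (ℕP.<⇒≱ (proj₁ q) p₁))
    ; ρ≤1⇔ = mk⇔ (λ _ → p₃) (λ _ → ℤP.≤-refl) }
  ρ-byCases (ofʸ p₁) (ofⁿ p₂) (ofⁿ p₃) _ xb≤yb = record
    { ρ≥0 = +≤+ ℕ.z≤n ; ρ≤2 = +≤+ (ℕ.s≤s ℕ.z≤n)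
    ; ρ≤0⇔ = mk⇔ (λ { (+≤+ ()) }) (λ q → ⊥-elim (ℕP.<⇒≱ (proj₁ q) p₁))
    ; ρ≤1⇔ = mk⇔ (λ _ → ⊥-elim (p₂ (ℕP.≤-trans (ℕP.≮⇒≥ p₃) xb≤yb)))
                 (λ _ → ℤP.≤-refl) }
  ρ-byCases (ofⁿ p₁) (ofʸ p₂) (ofʸ p₃) _ _ = record
    { ρ≥0 = +≤+ ℕ.z≤n ; ρ≤2 = +≤+ (ℕ.s≤s ℕ.z≤n)
    ; ρ≤0⇔ = mk⇔ (λ { (+≤+ ()) }) (λ q → ⊥-elim (ℕP.<⇒≱ (proj₂ q) p₂))
    ; ρ≤1⇔ = mk⇔ (λ _ → p₃) (λ _ → ℤP.≤-refl) }
  ρ-byCases (ofⁿ p₁) (ofʸ p₂) (ofⁿ p₃) xa≤ya _ = record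
    { ρ≥0 = +≤+ ℕ.z≤n ; ρ≤2 = +≤+ (ℕ.s≤s ℕ.z≤n)
    ; ρ≤0⇔ = mk⇔ (λ { (+≤+ ()) }) (λ q → ⊥-elim (ℕP.<⇒≱ (proj₂ q) p₂))
    ; ρ≤1⇔ = mk⇔ (λ _ → ℕP.<-≤-trans (ℕP.≰⇒> p₁) xa≤ya) (λ _ → ℤP.≤-refl) }
  ρ-byCases (ofⁿ p₁) (ofⁿ p₂) (ofʸ p₃) _ _ = record
    { ρ≥0 = +≤+ ℕ.z≤n ; ρ≤2 = +≤+ ℕ.z≤n
    ; ρ≤0⇔ = mk⇔ (λ _ → ℕP.≰⇒> p₁ , ℕP.≰⇒> p₂) (λ _ → ℤP.≤-refl)
    ; ρ≤1⇔ = mk⇔ (λ _ → p₃) (λ _ → +≤+ ℕ.z≤n) }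
  ρ-byCases (ofⁿ p₁) (ofⁿ p₂) (ofⁿ p₃) xa≤ya _ = record
    { ρ≥0 = +≤+ ℕ.z≤n ; ρ≤2 = +≤+ ℕ.z≤n
    ; ρ≤0⇔ = mk⇔ (λ _ → ℕP.≰⇒> p₁ , ℕP.≰⇒> p₂) (λ _ → ℤP.≤-refl)
    ; ρ≤1⇔ = mk⇔ (λ _ → ℕP.<-≤-trans (ℕP.≰⇒> p₁) xa≤ya) (λ _ → +≤+ ℕ.z≤n) }

ρ-spec : ∀ xa ya xb yb → xa ℕ.≤ ya → xb ℕ.≤ yb → ρSpec (ρ xa ya xb yb) xa ya xb yb
ρ-spec xa ya xb yb =
  ρ-byCases (ℕP.≤ᵇ-reflects-≤ xa xb) (ℕP.≤ᵇ-reflects-≤ ya yb) (ℕP.<ᵇ-reflects-< xb ya)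

Dominates : ℕ → SC → SC → Set
Dominates m a b = (ζ-rank m b < ζ-rank m a) × (η-rank m b < η-rank m a)

module _ {m : ℕ} where

  Small : ℤ → Set
  Small c = (ℤ.- + m < c) × (c < + m)

  small-diff : ∀ {p q} → (1 ℕ.≤ p) × (p ℕ.≤ m) → (1 ℕ.≤ q) × (q ℕ.≤ m) → Small (+ p - + q)
  small-diff {p} {q} (1≤p , p≤m) (1≤q , q≤m) =
    <-by (+ p + (+ m - + q)) (ℤP.+-mono-<-≤ (+<+ 1≤p) (ℤP.i≤j⇒0≤j-i (+≤+ q≤m)))
      (eq₁ (+ p) (+ q) (+ m)) ,
    <-by ((+ m - + p) + + q) (ℤP.+-mono-≤-< (ℤP.i≤j⇒0≤j-i (+≤+ p≤m)) (+<+ 1≤q))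
      (eq₂ (+ p) (+ q) (+ m))
    where
    eq₁ : ∀ p q m → p - q ≡ ℤ.- m + (p + (m - q))
    eq₁ = solve-∀
    eq₂ : ∀ p q m → m ≡ (p - q) + ((m - p) + q)
    eq₂ = solve-∀

  0<Hm+c : ∀ H c → + 1 ≤ H → ℤ.- + m < c → + 0 < H * + m + c
  0<Hm+c H c 1≤H -m<c = subst (+ 0 <_) (eq H c (+ m))
    (ℤP.+-mono-<-≤ (i<j⇒0<j-i -m<c) (ℤP.*-monoʳ-≤-nonNeg (+ m) (ℤP.i≤j⇒0≤j-i 1≤H)))
    where
    eq : ∀ H c m → (c - ℤ.- m) + (H - + 1) * m ≡ H * m + c
    eq = solve-∀

  Hm+c<0 : ∀ H c → H ≤ ℤ.- + 1 → c < + m → H * + m + c < + 0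
  Hm+c<0 H c H≤-1 c<m = 0<j-i⇒i<j (subst (+ 0 <_) (eq H c (+ m))
    (ℤP.+-mono-<-≤ (i<j⇒0<j-i c<m) (ℤP.*-monoʳ-≤-nonNeg (+ m) (ℤP.i≤j⇒0≤j-i H≤-1))))
    where
    eq : ∀ H c m → (m - c) + (ℤ.- (+ 1) - H) * m ≡ + 0 - (H * m + c)
    eq = solve-∀

  private
    ≰-negative : ∀ {r N} → + 0 ≤ r → N < + 0 → ¬ (r ≤ N)
    ≰-negative 0≤r N<0 r≤N = ℤP.<-irrefl refl (ℤP.≤-<-trans 0≤r (ℤP.≤-<-trans r≤N N<0))

  -- For each combination of parities of a and b these turn ρ ≤ num a − num b into
  -- positivity of the two rank differences H m + c; since ∣ c ∣ < m, the sign of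
  -- H m + c is that of H unless H = 0.

  even-threshold : ∀ H c₁ c₂ r → Small c₁ → Small c₂ → + 0 ≤ r → r ≤ + 2 →
                   (r ≤ + 0) ⇔ ((+ 0 < c₁) × (+ 0 < c₂)) →
                   (r ≤ H * + 2) ⇔ ((+ 0 < H * + m + c₁) × (+ 0 < H * + m + c₂))
  even-threshold H c₁ c₂ r s₁ s₂ 0≤r r≤2 r≤0⇔ with compare₃ H (+ 0)
  ... | inj₁ H≤-1 = mk⇔
    (λ r≤ → ⊥-elim (≰-negative 0≤r (ℤP.≤-<-trans (ℤP.*-monoʳ-≤-nonNeg (+ 2) H≤-1) -<+) r≤))
    (λ p → ⊥-elim (ℤP.<-asym (Hm+c<0 H c₁ H≤-1 (proj₂ s₁)) (proj₁ p)))
  ... | inj₂ (inj₁ refl) = subst₂ (λ u v → (r ≤ + 0) ⇔ ((+ 0 < u) × (+ 0 < v)))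
    (sym (ℤP.+-identityˡ c₁)) (sym (ℤP.+-identityˡ c₂)) r≤0⇔
  ... | inj₂ (inj₂ 1≤H) = mk⇔
    (λ _ → 0<Hm+c H c₁ 1≤H (proj₁ s₁) , 0<Hm+c H c₂ 1≤H (proj₁ s₂))
    (λ _ → ℤP.≤-trans r≤2 (ℤP.*-monoʳ-≤-nonNeg (+ 2) 1≤H))

  even-odd-threshold : ∀ H c₁ c₂ r → Small c₁ → Small c₂ → + 0 ≤ r → r ≤ + 2 →
                       (r ≤ + 1) ⇔ (+ 0 < c₂) →
                       (r ≤ H * + 2 - + 1) ⇔
                       ((+ 0 < H * + m + c₁) × (+ 0 < (H - + 1) * + m + c₂))
  even-odd-threshold H c₁ c₂ r s₁ s₂ 0≤r r≤2 r≤1⇔ with compare₃ H (+ 1)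
  ... | inj₁ H≤0 = mk⇔
    (λ r≤ → ⊥-elim (≰-negative 0≤r
      (ℤP.≤-<-trans (ℤP.+-monoˡ-≤ (ℤ.- + 1) (ℤP.*-monoʳ-≤-nonNeg (+ 2) H≤0)) -<+) r≤))
    (λ p → ⊥-elim (ℤP.<-asym (Hm+c<0 (H - + 1) c₂ (ℤP.+-monoˡ-≤ (ℤ.- + 1) H≤0) (proj₂ s₂))
                             (proj₂ p)))
  ... | inj₂ (inj₁ refl) = mk⇔
    (λ r≤ → 0<Hm+c (+ 1) c₁ ℤP.≤-refl (proj₁ s₁) ,
            subst (+ 0 <_) (sym (ℤP.+-identityˡ c₂)) (to r≤1⇔ r≤))
    (λ p → from r≤1⇔ (subst (+ 0 <_) (ℤP.+-identityˡ c₂) (proj₂ p)))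
  ... | inj₂ (inj₂ 2≤H) = mk⇔
    (λ _ → 0<Hm+c H c₁ (ℤP.≤-trans (+≤+ (ℕ.s≤s ℕ.z≤n)) 2≤H) (proj₁ s₁) ,
           0<Hm+c (H - + 1) c₂ (ℤP.+-monoˡ-≤ (ℤ.- + 1) 2≤H) (proj₁ s₂))
    (λ _ → ℤP.≤-trans r≤2 (ℤP.≤-trans (+≤+ (ℕ.s≤s (ℕ.s≤s ℕ.z≤n)))
             (ℤP.+-monoˡ-≤ (ℤ.- + 1) (ℤP.*-monoʳ-≤-nonNeg (+ 2) 2≤H))))

  odd-even-threshold : ∀ H c₁ c₂ r → Small c₁ → Small c₂ → + 0 ≤ r → r ≤ + 2 →
                       (r ≤ + 1) ⇔ (+ 0 < c₁) →
                       (r ≤ H * + 2 + + 1) ⇔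
                       ((+ 0 < H * + m + c₁) × (+ 0 < (H + + 1) * + m + c₂))
  odd-even-threshold H c₁ c₂ r s₁ s₂ 0≤r r≤2 r≤1⇔ with compare₃ H (+ 0)
  ... | inj₁ H≤-1 = mk⇔
    (λ r≤ → ⊥-elim (≰-negative 0≤r
      (ℤP.≤-<-trans (ℤP.+-monoˡ-≤ (+ 1) (ℤP.*-monoʳ-≤-nonNeg (+ 2) H≤-1)) -<+) r≤))
    (λ p → ⊥-elim (ℤP.<-asym (Hm+c<0 H c₁ H≤-1 (proj₂ s₁)) (proj₁ p)))
  ... | inj₂ (inj₁ refl) = mk⇔
    (λ r≤ → subst (+ 0 <_) (sym (ℤP.+-identityˡ c₁)) (to r≤1⇔ r≤) ,
            0<Hm+c (+ 1) c₂ ℤP.≤-refl (proj₁ s₂))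
    (λ p → from r≤1⇔ (subst (+ 0 <_) (ℤP.+-identityˡ c₁) (proj₁ p)))
  ... | inj₂ (inj₂ 1≤H) = mk⇔
    (λ _ → 0<Hm+c H c₁ 1≤H (proj₁ s₁) ,
           0<Hm+c (H + + 1) c₂ (ℤP.≤-trans 1≤H (ℤP.i≤i+j H (+ 1))) (proj₁ s₂))
    (λ _ → ℤP.≤-trans r≤2 (ℤP.≤-trans (+≤+ (ℕ.s≤s (ℕ.s≤s ℕ.z≤n)))
             (ℤP.+-monoˡ-≤ (+ 1) (ℤP.*-monoʳ-≤-nonNeg (+ 2) 1≤H))))

private
  linear-diff : ∀ {X Y H} k p q u v → X ≡ p * k + u → Y ≡ q * k + v → p - q ≡ H →
                X - Y ≡ H * k + (u - v)
  linear-diff k p q u v refl refl refl = eq p q k u v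
    where
    eq : ∀ p q k u v → (p * k + u) - (q * k + v) ≡ (p - q) * k + (u - v)
    eq = solve-∀

  ≫⇔Dominates-from : ∀ {m a b N Z E} → num a - num b ≡ N →
                     ζ-rank m a - ζ-rank m b ≡ Z → η-rank m a - η-rank m b ≡ E →
                     (ρ (x a) (y a) (x b) (y b) ≤ N) ⇔ ((+ 0 < Z) × (+ 0 < E)) →
                     (a ≫ b) ⇔ Dominates m a b
  ≫⇔Dominates-from refl refl refl threshold = ⇔-sym (i<j⇔0<j-i ×-⇔ i<j⇔0<j-i) ⇔-∘ threshold

  x-range : ∀ {m} e → ValidSC m e → (1 ℕ.≤ x e) × (x e ℕ.≤ m)
  x-range _ (1≤x , x≤y , y≤m) = 1≤x , ℕP.≤-trans x≤y y≤m

  y-range : ∀ {m} e → ValidSC m e → (1 ℕ.≤ y e) × (y e ℕ.≤ m)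
  y-range _ (1≤x , x≤y , y≤m) = ℕP.≤-trans 1≤x x≤y , y≤m

≫⇔Dominates : ∀ {m a b} → ValidSC m a → ValidSC m b → (a ≫ b) ⇔ Dominates m a b
≫⇔Dominates {m} {a} {b} va vb = by-parity (parityView m a) (parityView m b)
  where
  open ρSpec (ρ-spec (x a) (y a) (x b) (y b) (proj₁ (proj₂ va)) (proj₁ (proj₂ vb)))

  xa = x-range a va ; ya = y-range a va ; xb = x-range b vb ; yb = y-range b vb

  by-parity : ParityView m a → ParityView m b → (a ≫ b) ⇔ Dominates m a b
  by-parity (even ha na ζa ηa) (even hb nb ζb ηb) =
    ≫⇔Dominates-from {m} {a} {b} (trans (cong₂ _-_ na nb) (eq ha hb))
      (linear-diff (+ m) ha hb (+ x a) (+ x b) ζa ζb refl)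
      (linear-diff (+ m) ha hb (+ y a) (+ y b) ηa ηb refl)
      (even-threshold (ha - hb) _ _ _ (small-diff xa xb) (small-diff ya yb) ρ≥0 ρ≤2
        ((m<n⇔0<n-m _ _ ×-⇔ m<n⇔0<n-m _ _) ⇔-∘ ρ≤0⇔))
    where
    eq : ∀ a b → a * + 2 - b * + 2 ≡ (a - b) * + 2
    eq = solve-∀
  by-parity (odd ha na ζa ηa) (odd hb nb ζb ηb) =
    ≫⇔Dominates-from {m} {a} {b} (trans (cong₂ _-_ na nb) (eq ha hb))
      (linear-diff (+ m) ha hb (+ y a) (+ y b) ζa ζb refl)
      (linear-diff (+ m) (ha + + 1) (hb + + 1) (+ x a) (+ x b) ηa ηb (shift ha hb))
      (even-threshold (ha - hb) _ _ _ (small-diff ya yb) (small-diff xa xb) ρ≥0 ρ≤2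
        ((m<n⇔0<n-m _ _ ×-⇔ m<n⇔0<n-m _ _) ⇔-∘ (mk⇔ swap swap ⇔-∘ ρ≤0⇔)))
    where
    eq : ∀ a b → (a * + 2 + + 1) - (b * + 2 + + 1) ≡ (a - b) * + 2
    eq = solve-∀
    shift : ∀ a b → (a + + 1) - (b + + 1) ≡ a - b
    shift = solve-∀
  by-parity (even ha na ζa ηa) (odd hb nb ζb ηb) =
    ≫⇔Dominates-from {m} {a} {b} (trans (cong₂ _-_ na nb) (eq ha hb))
      (linear-diff (+ m) ha hb (+ x a) (+ y b) ζa ζb refl)
      (linear-diff (+ m) ha (hb + + 1) (+ y a) (+ x b) ηa ηb (shift ha hb))
      (even-odd-threshold (ha - hb) _ _ _ (small-diff xa yb) (small-diff ya xb) ρ≥0 ρ≤2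
        (m<n⇔0<n-m _ _ ⇔-∘ ρ≤1⇔))
    where
    eq : ∀ a b → a * + 2 - (b * + 2 + + 1) ≡ (a - b) * + 2 - + 1
    eq = solve-∀
    shift : ∀ a b → a - (b + + 1) ≡ (a - b) - + 1
    shift = solve-∀
  by-parity (odd ha na ζa ηa) (even hb nb ζb ηb) =
    ≫⇔Dominates-from {m} {a} {b} (trans (cong₂ _-_ na nb) (eq ha hb))
      (linear-diff (+ m) ha hb (+ y a) (+ x b) ζa ζb refl)
      (linear-diff (+ m) (ha + + 1) hb (+ x a) (+ y b) ηa ηb (shift ha hb))
      (odd-even-threshold (ha - hb) _ _ _ (small-diff ya xb) (small-diff xa yb) ρ≥0 ρ≤2
        (m<n⇔0<n-m _ _ ⇔-∘ ρ≤1⇔))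
    where
    eq : ∀ a b → (a * + 2 + + 1) - b * + 2 ≡ (a - b) * + 2 + + 1
    eq = solve-∀
    shift : ∀ a b → (a + + 1) - b ≡ (a - b) + + 1
    shift = solve-∀

-- l_d ⋗ l′_d′ when l′_d′ lies strictly inside the downward cone ∣ d − d′ ∣ < l − l′ of l_d;
-- a path, having slopes ±1, never contains two such symbols.
_⋗_ : Sym → Sym → Set
(l , d) ⋗ (l′ , d′) = (+ d - + d′ < l - l′) × (+ d′ - + d < l - l′)

⋗-trans : ∀ {P Q R} → P ⋗ Q → Q ⋗ R → P ⋗ R
⋗-trans {l₁ , d₁} {l₂ , d₂} {l₃ , d₃} (p₁ , q₁) (p₂ , q₂) =
  subst₂ _<_ (chain (+ d₁) (+ d₂) (+ d₃)) (chain l₁ l₂ l₃) (ℤP.+-mono-< p₁ p₂) ,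
  subst₂ _<_ (chain′ (+ d₁) (+ d₂) (+ d₃)) (chain l₁ l₂ l₃) (ℤP.+-mono-< q₁ q₂)
  where
  chain : ∀ a b c → (a - b) + (b - c) ≡ a - c
  chain = solve-∀
  chain′ : ∀ a b c → (b - a) + (c - b) ≡ c - a
  chain′ = solve-∀

⋗-irrefl : ∀ {P} → ¬ (P ⋗ P)
⋗-irrefl {l , d} (p , _) =
  ℤP.<-irrefl refl (subst₂ _<_ (ℤP.+-inverseʳ (+ d)) (ℤP.+-inverseʳ l) p)

⋗⇒size> : ∀ {P Q} → P ⋗ Q → proj₁ Q < proj₁ P
⋗⇒size> {l₁ , d₁} {l₂ , d₂} (p , q) = 0<j-i⇒i<j (ℤP.*-cancelˡ-<-nonNeg (+ 2)
  (subst₂ _<_ (eq₁ (+ d₁) (+ d₂)) (eq₂ (l₁ - l₂)) (ℤP.+-mono-< p q)))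
  where
  eq₁ : ∀ a b → (a - b) + (b - a) ≡ + 2 * + 0
  eq₁ = solve-∀
  eq₂ : ∀ L → L + L ≡ + 2 * L
  eq₂ = solve-∀

_⋗?_ : ∀ P Q → Dec (P ⋗ Q)
(l , d) ⋗? (l′ , d′) = ((+ d - + d′) ℤP.<? (l - l′)) ×-dec ((+ d′ - + d) ℤP.<? (l - l′))

private
  cone-coordinate : ∀ α β {D L} → L - D ≡ + 2 * (α - β) → (β < α) ⇔ (D < L)
  cone-coordinate α β {D} {L} eq = mk⇔
    (λ β<α → 0<j-i⇒i<j (subst (+ 0 <_) (sym eq) (ℤP.*-monoˡ-<-pos (+ 2) (i<j⇒0<j-i β<α))))
    (λ D<L → 0<j-i⇒i<j
      (ℤP.*-cancelˡ-<-nonNeg {i = + 0} (+ 2) (subst (+ 0 <_) eq (i<j⇒0<j-i D<L))))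

size-𝟙 : ∀ m e → proj₁ (𝟙 m e) ≡ η-rank m e + ζ-rank m e - + suc m
size-𝟙 m e = cong proj₁ (𝟙≡ranks m e)

index-𝟙 : ∀ {m} e → ValidSC m e → + proj₂ (𝟙 m e) ≡ η-rank m e - ζ-rank m e
index-𝟙 {m} e ve =
  trans (cong (λ P → + proj₂ P) (𝟙≡ranks m e)) (ℤP.0≤i⇒+∣i∣≡i (proj₁ (rank-gap {m} {e} ve)))

Dominates⇔𝟙⋗𝟙 : ∀ {m a b} → ValidSC m a → ValidSC m b → Dominates m a b ⇔ (𝟙 m a ⋗ 𝟙 m b)
Dominates⇔𝟙⋗𝟙 {m} {a} {b} va vb =
  cone-coordinate ζa ζb (trans (cong₂ _-_ Δl≡ (Δd≡ a b va vb)) (ζ-eq ηa ζa ηb ζb (+ suc m))) ×-⇔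
  cone-coordinate ηa ηb (trans (cong₂ _-_ Δl≡ (Δd≡ b a vb va)) (η-eq ηa ζa ηb ζb (+ suc m)))
  where
  ηa = η-rank m a ; ζa = ζ-rank m a ; ηb = η-rank m b ; ζb = ζ-rank m b
  Δl≡ : proj₁ (𝟙 m a) - proj₁ (𝟙 m b) ≡ (ηa + ζa - + suc m) - (ηb + ζb - + suc m)
  Δl≡ = cong₂ _-_ (size-𝟙 m a) (size-𝟙 m b)
  Δd≡ : ∀ a b → ValidSC m a → ValidSC m b → + proj₂ (𝟙 m a) - + proj₂ (𝟙 m b) ≡
        (η-rank m a - ζ-rank m a) - (η-rank m b - ζ-rank m b)
  Δd≡ a b va vb = cong₂ _-_ (index-𝟙 a va) (index-𝟙 b vb)
  ζ-eq : ∀ ηa ζa ηb ζb s →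
         ((ηa + ζa - s) - (ηb + ζb - s)) - ((ηa - ζa) - (ηb - ζb)) ≡ + 2 * (ζa - ζb)
  ζ-eq = solve-∀
  η-eq : ∀ ηa ζa ηb ζb s →
         ((ηa + ζa - s) - (ηb + ζb - s)) - ((ηb - ζb) - (ηa - ζa)) ≡ + 2 * (ηa - ηb)
  η-eq = solve-∀

private
  two∣⇒even : ∀ i → (+ 2) ℤ∣.∣ i → Σ ℤ (λ t → i ≡ t * + 2)
  two∣⇒even (+ n) (divides q eq) = + q , trans (cong +_ eq) (ℤP.pos-* q 2)
  two∣⇒even -[1+ n ] (divides q eq) =
    ℤ.- + q , trans (cong (λ k → ℤ.- + k) eq)
                    (trans (cong ℤ.-_ (ℤP.pos-* q 2)) (ℤP.neg-distribˡ-* (+ q) (+ 2)))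

  sc-cong : ∀ {n n′ x x′ y y′} → n ≡ n′ → x ≡ x′ → y ≡ y′ → sc n x y ≡ sc n′ x′ y′
  sc-cong refl refl refl = refl

  even⇒two∣ : ∀ i t → i ≡ t * + 2 → (+ 2) ℤ∣.∣ i
  even⇒two∣ i t eq = divides ∣ t ∣ (trans (cong ∣_∣ eq) (ℤP.abs-* t (+ 2)))

module Inverse (m : ℕ) .{{_ : NonZero m}} where

  s : ℤ
  s = + suc m

  -- Every integer is a rank: r = k m + j with 1 ≤ j ≤ m.
  quotient : ℤ → ℤ
  quotient r = (r - + 1) /ℕ m

  colour : ℤ → ℕ
  colour r = suc ((r - + 1) %ℕ m)

  colour≤m : ∀ r → colour r ℕ.≤ m
  colour≤m r = n%ℕd<d (r - + 1) m

  rank-decomposition : ∀ r → r ≡ quotient r * + m + + colour r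
  rank-decomposition r = begin
    r                                              ≡⟨ eq₁ r ⟩
    (r - + 1) + + 1                                ≡⟨ cong (_+ + 1) (a≡a%ℕn+[a/ℕn]*n (r - + 1) m) ⟩
    (+ ((r - + 1) %ℕ m) + quotient r * + m) + + 1 ≡⟨ eq₂ (+ ((r - + 1) %ℕ m)) (quotient r) (+ m) ⟩
    quotient r * + m + + colour r                  ∎
    where
    open ≡-Reasoning
    eq₁ : ∀ r → r ≡ (r - + 1) + + 1
    eq₁ = solve-∀
    eq₂ : ∀ c q m → (c + q * m) + + 1 ≡ q * m + (+ 1 + c)
    eq₂ = solve-∀

  rank-decomposition-unique : ∀ r k j → 1 ℕ.≤ j → j ℕ.≤ m → r ≡ k * + m + + j →
                              (quotient r ≡ k) × (colour r ≡ j)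
  rank-decomposition-unique r k (suc j) _ j<m refl
    with /ℕ-%ℕ-unique m (k * + m + + suc j - + 1) k j j<m (eq k (+ m) (+ j))
    where
    eq : ∀ k m j → (k * m + (+ 1 + j)) - + 1 ≡ j + k * m
    eq = solve-∀
  ... | q≡ , r≡ = q≡ , cong suc r≡

  private
    rank-diff : ∀ u v → v - u ≡ (quotient v - quotient u) * + m + (+ colour v - + colour u)
    rank-diff u v = trans (cong₂ _-_ (rank-decomposition v) (rank-decomposition u))
      (eq (quotient v) (quotient u) (+ m) (+ colour v) (+ colour u))
      where
      eq : ∀ a b m p q → (a * m + p) - (b * m + q) ≡ (a - b) * m + (p - q)
      eq = solve-∀

    small-colour-diff : ∀ u v → Small {m} (+ colour v - + colour u)
    small-colour-diff u v = small-diff (ℕ.s≤s ℕ.z≤n , colour≤m v) (ℕ.s≤s ℕ.z≤n , colour≤m u)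

  quotient-step : ∀ u v → + 0 ≤ v - u → v - u ≤ + m → quotient v ≢ quotient u →
                  quotient v ≡ quotient u + + 1
  quotient-step u v 0≤v-u v-u≤m q≢ with compare₃ (quotient v - quotient u) (+ 0)
  ... | inj₁ Q≤-1 = ⊥-elim (ℤP.<-irrefl refl (ℤP.≤-<-trans 0≤v-u
    (subst (_< + 0) (sym (rank-diff u v)) (Hm+c<0 _ _ Q≤-1 (proj₂ (small-colour-diff u v))))))
  ... | inj₂ (inj₁ Q≡0) = ⊥-elim (q≢ (ℤP.i-j≡0⇒i≡j _ _ Q≡0))
  ... | inj₂ (inj₂ 1≤Q) with compare₃ (quotient v - quotient u) (+ 1)
  ...   | inj₁ Q≤0 =
    ⊥-elim (ℤP.<-irrefl refl (ℤP.<-≤-trans (+<+ (ℕ.s≤s ℕ.z≤n)) (ℤP.≤-trans 1≤Q Q≤0)))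
  ...   | inj₂ (inj₁ Q≡1) = trans (eq (quotient v) (quotient u)) (cong (λ z → quotient u + z) Q≡1)
    where
    eq : ∀ a b → a ≡ b + (a - b)
    eq = solve-∀
  ...   | inj₂ (inj₂ 2≤Q) = ⊥-elim (ℤP.<-irrefl refl (ℤP.≤-<-trans v-u≤m (0<j-i⇒i<j
    (subst (+ 0 <_) (eq (quotient v - quotient u) (+ m) _ (v - u) (rank-diff u v))
      (0<Hm+c _ _ (ℤP.+-monoˡ-≤ (ℤ.- + 1) 2≤Q) (proj₁ (small-colour-diff u v)))))))
    where
    eq : ∀ Q m c D → D ≡ Q * m + c → (Q - + 1) * m + c ≡ D - m
    eq Q m c D refl = eq′ Q m c
      where
      eq′ : ∀ Q m c → (Q - + 1) * m + c ≡ (Q * m + c) - m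
      eq′ = solve-∀

  fromRanks : ℤ → ℤ → SC
  fromRanks u v with quotient v ℤP.≟ quotient u
  ... | yes _ = sc (quotient u * + 2) (colour u) (colour v)
  ... | no _  = sc (quotient u * + 2 + + 1) (colour v) (colour u)

  fromRanks-spec : ∀ u v → + 0 ≤ v - u → v - u ≤ + m →
                   (ζ-rank m (fromRanks u v) ≡ u) × (η-rank m (fromRanks u v) ≡ v) ×
                   ValidSC m (fromRanks u v)
  fromRanks-spec u v 0≤v-u v-u≤m with quotient v ℤP.≟ quotient u
  ... | yes q≡ =
    trans ζ≡ (sym (rank-decomposition u)) ,
    trans η≡ (trans (cong (λ k → k * + m + + colour v) (sym q≡)) (sym (rank-decomposition v))) ,
    ℕ.s≤s ℕ.z≤n , ℤP.drop‿+≤+ (ℤP.0≤i-j⇒j≤i (subst (+ 0 ≤_) colour-gap 0≤v-u)) , colour≤m v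
    where
    ζ≡ = proj₁ (ranks-of-even m (quotient u) (colour u) (colour v))
    η≡ = proj₂ (ranks-of-even m (quotient u) (colour u) (colour v))
    colour-gap : v - u ≡ + colour v - + colour u
    colour-gap = trans (rank-diff u v)
      (trans (cong (λ k → (k - quotient u) * + m + (+ colour v - + colour u)) q≡)
             (eq (quotient u) (+ m) _))
      where
      eq : ∀ k m c → (k - k) * m + c ≡ c
      eq = solve-∀
  ... | no q≢ =
    trans ζ≡ (sym (rank-decomposition u)) ,
    trans η≡ (trans (cong (λ k → k * + m + + colour v) (sym q+1)) (sym (rank-decomposition v))) ,
    ℕ.s≤s ℕ.z≤n , ℤP.drop‿+≤+ (ℤP.i-j≤0⇒i≤j colour-gap≤0) , colour≤m u
    where
    ζ≡ = proj₁ (ranks-of-odd m (quotient u) (colour v) (colour u))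
    η≡ = proj₂ (ranks-of-odd m (quotient u) (colour v) (colour u))
    q+1 = quotient-step u v 0≤v-u v-u≤m q≢
    colour-gap : v - u ≡ + m + (+ colour v - + colour u)
    colour-gap = trans (rank-diff u v)
      (trans (cong (λ k → (k - quotient u) * + m + (+ colour v - + colour u)) q+1)
             (eq (quotient u) (+ m) _))
      where
      eq : ∀ k m c → (k + + 1 - k) * m + c ≡ m + c
      eq = solve-∀
    colour-gap≤0 : + colour v - + colour u ≤ + 0
    colour-gap≤0 = subst₂ _≤_ (eq (+ m) _) (ℤP.+-inverseʳ (+ m))
      (ℤP.+-monoˡ-≤ (ℤ.- + m) (subst (_≤ + m) colour-gap v-u≤m))
      where
      eq : ∀ m c → m + c - m ≡ c
      eq = solve-∀

  fromRanks-ranks : ∀ e → ValidSC m e → fromRanks (ζ-rank m e) (η-rank m e) ≡ e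
  fromRanks-ranks e ve with parityView m e
  ... | even h num≡ ζ≡ η≡
    with rank-decomposition-unique _ h (x e) (proj₁ (x-range e ve)) (proj₂ (x-range e ve)) ζ≡
       | rank-decomposition-unique _ h (y e) (proj₁ (y-range e ve)) (proj₂ (y-range e ve)) η≡
  ...   | qζ , cζ | qη , cη with quotient (η-rank m e) ℤP.≟ quotient (ζ-rank m e)
  ...     | yes _  = sc-cong (trans (cong (_* + 2) qζ) (sym num≡)) cζ cη
  ...     | no q≢ = ⊥-elim (q≢ (trans qη (sym qζ)))
  fromRanks-ranks e ve | odd h num≡ ζ≡ η≡
    with rank-decomposition-unique _ h (y e) (proj₁ (y-range e ve)) (proj₂ (y-range e ve)) ζ≡
       | rank-decomposition-unique _ (h + + 1) (x e) (proj₁ (x-range e ve)) (proj₂ (x-range e ve)) η≡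
  ...   | qζ , cζ | qη , cη with quotient (η-rank m e) ℤP.≟ quotient (ζ-rank m e)
  ...     | yes q≡ =
    ⊥-elim (ℤP.<-irrefl (sym (trans (sym qη) (trans q≡ qζ)))
                        (<-by (+ 1) (+<+ (ℕ.s≤s ℕ.z≤n)) refl))
  ...     | no _  = sc-cong (trans (cong (λ k → k * + 2 + + 1) qζ) (sym num≡)) cη cζ

  ζ-coord η-coord : Sym → ℤ
  ζ-coord (l , d) = (l + s - + d) /ℕ 2
  η-coord (l , d) = (l + s + + d) /ℕ 2

  𝟙⁻¹ : Sym → SC
  𝟙⁻¹ P = fromRanks (ζ-coord P) (η-coord P)

  module _ {k : ℤ} {l : ℤ} {d : ℕ} (P∈E : InE m k (l , d)) where

    private
      parity = two∣⇒even (l - + d - s) (proj₂ (proj₂ P∈E))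
      t = proj₁ parity

      l≡ : l ≡ t * + 2 + + d + s
      l≡ = trans (eq l (+ d) s) (cong (λ z → z + + d + s) (proj₂ parity))
        where
        eq : ∀ l d s → l ≡ (l - d - s) + d + s
        eq = solve-∀

      ζ-coord≡ : ζ-coord (l , d) ≡ t + s
      ζ-coord≡ = trans (cong (_/ℕ 2) (trans (cong (λ z → z + s - + d) l≡) (eq t (+ d) s)))
                       (2*i/ℕ2≡i (t + s))
        where
        eq : ∀ t d s → (t * + 2 + d + s) + s - d ≡ + 2 * (t + s)
        eq = solve-∀

      η-coord≡ : η-coord (l , d) ≡ t + s + + d
      η-coord≡ = trans (cong (_/ℕ 2) (trans (cong (λ z → z + s + + d) l≡) (eq t (+ d) s)))
                       (2*i/ℕ2≡i (t + s + + d))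
        where
        eq : ∀ t d s → (t * + 2 + d + s) + s + d ≡ + 2 * (t + s + d)
        eq = solve-∀

    coord-gap : η-coord (l , d) - ζ-coord (l , d) ≡ + d
    coord-gap = trans (cong₂ _-_ η-coord≡ ζ-coord≡) (eq t (+ d) s)
      where
      eq : ∀ t d s → (t + s + d) - (t + s) ≡ d
      eq = solve-∀

    2*ζ-coord : + 2 * ζ-coord (l , d) ≡ l + s - + d
    2*ζ-coord = trans (cong (+ 2 *_) ζ-coord≡)
                      (trans (eq t (+ d) s) (cong (λ z → z + s - + d) (sym l≡)))
      where
      eq : ∀ t d s → + 2 * (t + s) ≡ (t * + 2 + d + s) + s - d
      eq = solve-∀

    2*ζ-coord+d : + 2 * ζ-coord (l , d) + + d - s ≡ l
    2*ζ-coord+d = trans (cong (λ z → z + + d - s) 2*ζ-coord) (eq l s (+ d))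
      where
      eq : ∀ l s d → l + s - d + d - s ≡ l
      eq = solve-∀

    private
      spec = fromRanks-spec (ζ-coord (l , d)) (η-coord (l , d))
        (subst (+ 0 ≤_) (sym coord-gap) (+≤+ ℕ.z≤n))
        (subst (_≤ + m) (sym coord-gap) (+≤+ (proj₁ (proj₂ P∈E))))

    𝟙⁻¹-valid : ValidSC m (𝟙⁻¹ (l , d))
    𝟙⁻¹-valid = proj₂ (proj₂ spec)

    𝟙∘𝟙⁻¹ : 𝟙 m (𝟙⁻¹ (l , d)) ≡ (l , d)
    𝟙∘𝟙⁻¹ = trans (𝟙≡ranks m (𝟙⁻¹ (l , d))) (cong₂ _,_ size≡ (cong ∣_∣ index≡))
      where
      ζ≡ = trans (proj₁ spec) ζ-coord≡
      η≡ = trans (proj₁ (proj₂ spec)) η-coord≡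
      size≡ : η-rank m (𝟙⁻¹ (l , d)) + ζ-rank m (𝟙⁻¹ (l , d)) - s ≡ l
      size≡ = trans (cong₂ (λ a b → a + b - s) η≡ ζ≡) (trans (eq t (+ d) s) (sym l≡))
        where
        eq : ∀ t d s → (t + s + d) + (t + s) - s ≡ t * + 2 + d + s
        eq = solve-∀
      index≡ : η-rank m (𝟙⁻¹ (l , d)) - ζ-rank m (𝟙⁻¹ (l , d)) ≡ + d
      index≡ = trans (cong₂ _-_ (proj₁ (proj₂ spec)) (proj₁ spec)) coord-gap

  𝟙⁻¹∘𝟙 : ∀ e → ValidSC m e → 𝟙⁻¹ (𝟙 m e) ≡ e
  𝟙⁻¹∘𝟙 e ve = trans (cong₂ fromRanks ζ≡ η≡) (fromRanks-ranks e ve)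
    where
    ζ̂ = ζ-rank m e ; η̂ = η-rank m e
    l≡ = size-𝟙 m e
    d≡ = index-𝟙 e ve
    ζ≡ : ζ-coord (𝟙 m e) ≡ ζ̂
    ζ≡ = trans (cong (_/ℕ 2) (trans (cong₂ (λ l d → l + s - d) l≡ d≡) (eq η̂ ζ̂ s)))
               (2*i/ℕ2≡i ζ̂)
      where
      eq : ∀ a b s → a + b - s + s - (a - b) ≡ + 2 * b
      eq = solve-∀
    η≡ : η-coord (𝟙 m e) ≡ η̂
    η≡ = trans (cong (_/ℕ 2) (trans (cong₂ (λ l d → l + s + d) l≡ d≡) (eq η̂ ζ̂ s)))
               (2*i/ℕ2≡i η̂)
      where
      eq : ∀ a b s → a + b - s + s + (a - b) ≡ + 2 * a
      eq = solve-∀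

𝟙∈E : ∀ {m k} e → ValidSC m e → k ≤ proj₁ (𝟙 m e) → InE m k (𝟙 m e)
𝟙∈E {m} e ve k≤l =
  k≤l ,
  ℤP.drop‿+≤+ (subst (_≤ + m) (sym (index-𝟙 e ve)) (proj₂ (rank-gap {m} {e} ve))) ,
  even⇒two∣ _ (ζ̂ - s)
    (trans (cong₂ (λ l d → l - d - s) (size-𝟙 m e) (index-𝟙 e ve)) (eq η̂ ζ̂ s))
  where
  s = + suc m ; ζ̂ = ζ-rank m e ; η̂ = η-rank m e
  eq : ∀ a b s → a + b - s - (a - b) - s ≡ (b - s) * + 2
  eq = solve-∀

record ΩSpec (m : ℕ) (ω : SC) : Set where
  field
    ω-valid   : ValidSC m ω
    size-𝟙ω≥-1 : ℤ.- + 1 ≤ proj₁ (𝟙 m ω)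
    size-𝟙ω<1  : proj₁ (𝟙 m ω) < + 1

private
  i≤⌊n/2⌋⇒i≤n∸i : ∀ {i} n → i ℕ.≤ ℕ.⌊ n /2⌋ → i ℕ.≤ n ℕ.∸ i
  i≤⌊n/2⌋⇒i≤n∸i {i} n i≤⌊n/2⌋ =
    subst (ℕ._≤ n ℕ.∸ i) (ℕP.m+n∸m≡n i i) (ℕP.∸-monoˡ-≤ i i+i≤n)
    where
    i+i≤n : i ℕ.+ i ℕ.≤ n
    i+i≤n = subst (i ℕ.+ i ℕ.≤_) (ℕP.⌊n/2⌋+⌈n/2⌉≡n n)
      (ℕP.+-mono-≤ i≤⌊n/2⌋ (ℕP.≤-trans i≤⌊n/2⌋ (ℕP.⌊n/2⌋≤⌈n/2⌉ n)))

  +[n∸i]+i≡n : ∀ {i n} → i ℕ.≤ n ℕ.∸ i → + (n ℕ.∸ i) + + i ≡ + n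
  +[n∸i]+i≡n {i} {n} i≤n-i =
    trans (sym (ℤP.pos-+ (n ℕ.∸ i) i)) (cong +_ (ℕP.m∸n+n≡m (ℕP.≤-trans i≤n-i (ℕP.m∸n≤m n i))))

  size-𝟙-sc₀ : ∀ m x y → proj₁ (𝟙 m (sc (+ 0) x y)) ≡ + y + + x - + suc m
  size-𝟙-sc₀ m x y = trans (size-𝟙 m (sc (+ 0) x y))
    (cong₂ (λ a b → a + b - + suc m) (trans (proj₂ ranks) (ℤP.+-identityˡ (+ y)))
                                      (trans (proj₁ ranks) (ℤP.+-identityˡ (+ x))))
    where
    ranks = ranks-of-even m (+ 0) x y

Ω-spec : ∀ {m ω} → 1 ℕ.≤ m → InΩ m ω → ΩSpec m ω
Ω-spec {m} 1≤m ω-zero = record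
  { ω-valid = 1≤m , ℕP.≤-refl , ℕP.≤-refl
  ; size-𝟙ω≥-1 = ℤP.≤-reflexive (sym size≡)
  ; size-𝟙ω<1 = subst (_< + 1) (sym size≡) -<+ }
  where
  ranks = ranks-of-odd m (ℤ.- + 1) m m
  eq : ∀ M → ((ℤ.- (+ 1) + + 1) * M + M) + (ℤ.- (+ 1) * M + M) - (+ 1 + M) ≡ ℤ.- (+ 1)
  eq = solve-∀
  size≡ : proj₁ (𝟙 m (sc -[1+ 0 ] m m)) ≡ ℤ.- + 1
  size≡ = trans (size-𝟙 m (sc -[1+ 0 ] m m))
    (trans (cong₂ (λ a b → a + b - + suc m) (proj₂ ranks) (proj₁ ranks)) (eq (+ m)))
Ω-spec {m} _ (ω-pos i 1≤i i≤⌊m/2⌋) = record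
  { ω-valid = 1≤i , i≤m-i , ℕP.m∸n≤m m i
  ; size-𝟙ω≥-1 = ℤP.≤-reflexive (sym size≡)
  ; size-𝟙ω<1 = subst (_< + 1) (sym size≡) -<+ }
  where
  i≤m-i = i≤⌊n/2⌋⇒i≤n∸i m i≤⌊m/2⌋
  eq : ∀ M → M - (+ 1 + M) ≡ ℤ.- + 1
  eq = solve-∀
  size≡ : proj₁ (𝟙 m (sc (+ 0) i (m ℕ.∸ i))) ≡ ℤ.- + 1
  size≡ = trans (size-𝟙-sc₀ m i (m ℕ.∸ i)) (trans (cong (_- + suc m) (+[n∸i]+i≡n i≤m-i)) (eq (+ m)))
Ω-spec {m} _ (ω-bar (suc u) _ u<⌈m/2⌉) = record
  { ω-valid = ℕ.s≤s ℕ.z≤n , u<m-u , ℕP.m∸n≤m m u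
  ; size-𝟙ω≥-1 = ℤP.≤-trans -≤+ (ℤP.≤-reflexive (sym size≡))
  ; size-𝟙ω<1 = subst (_< + 1) (sym size≡) (+<+ (ℕ.s≤s ℕ.z≤n)) }
  where
  u<m-u = i≤⌊n/2⌋⇒i≤n∸i (suc m) u<⌈m/2⌉
  size≡ : proj₁ (𝟙 m (sc (+ 0) (suc u) (m ℕ.∸ u))) ≡ + 0
  size≡ = trans (size-𝟙-sc₀ m (suc u) (m ℕ.∸ u))
    (trans (cong (_- + suc m) (+[n∸i]+i≡n {suc u} {suc m} u<m-u)) (ℤP.+-inverseʳ (+ suc m)))

monotone-by-steps : ∀ n (g : Fin (suc n) → ℤ) →
                    (∀ (j : Fin n) → g (inject₁ j) ≤ g (Fin.suc j)) →
                    ∀ {i j} → i Fin.≤ j → g i ≤ g j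
monotone-by-steps n g step {Fin.zero} {Fin.zero} _ = ℤP.≤-refl
monotone-by-steps (suc n) g step {Fin.zero} {Fin.suc j} _ =
  ℤP.≤-trans (step Fin.zero)
             (monotone-by-steps n (g ∘ Fin.suc) (step ∘ Fin.suc) {Fin.zero} {j} ℕ.z≤n)
monotone-by-steps (suc n) g step {Fin.suc i} {Fin.suc j} (ℕ.s≤s i≤j) =
  monotone-by-steps n (g ∘ Fin.suc) (step ∘ Fin.suc) i≤j

module _ {m : ℕ} (p : Path m) where

  private
    -- Along a path, l + d never decreases and d − l never decreases.
    ascent descent : Fin (suc m) → ℤ
    ascent i = L p i + + toℕ i
    descent i = + toℕ i - L p i

    step-bounds : ∀ a b t → (b ≡ a + + 1) ⊎ (b ≡ a - + 1) →
                  (a + t ≤ b + (+ 1 + t)) × (t - a ≤ (+ 1 + t) - b)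
    step-bounds a b t (inj₁ refl) =
      ≤-by (+ 2) (+≤+ ℕ.z≤n) (eq₁ a t) , ℤP.≤-reflexive (eq₂ a t)
      where
      eq₁ : ∀ a t → a + + 1 + (+ 1 + t) ≡ a + t + + 2
      eq₁ = solve-∀
      eq₂ : ∀ a t → t - a ≡ (+ 1 + t) - (a + + 1)
      eq₂ = solve-∀
    step-bounds a b t (inj₂ refl) =
      ℤP.≤-reflexive (eq₁ a t) , ≤-by (+ 2) (+≤+ ℕ.z≤n) (eq₂ a t)
      where
      eq₁ : ∀ a t → a + t ≡ a - + 1 + (+ 1 + t)
      eq₁ = solve-∀
      eq₂ : ∀ a t → (+ 1 + t) - (a - + 1) ≡ t - a + + 2
      eq₂ = solve-∀

    bounds-at : ∀ j → (ascent (inject₁ j) ≤ ascent (Fin.suc j)) ×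
                      (descent (inject₁ j) ≤ descent (Fin.suc j))
    bounds-at j = subst (λ t → (a + + t ≤ ascent (Fin.suc j)) × (+ t - a ≤ descent (Fin.suc j)))
                        (sym (FinP.toℕ-inject₁ j))
                        (step-bounds a (L p (Fin.suc j)) (+ toℕ j) (steps p j))
      where
      a = L p (inject₁ j)

  path-antichain : ∀ i j → ¬ ((L p i , toℕ i) ⋗ (L p j , toℕ j))
  path-antichain i j (i-j<Δ , j-i<Δ) with ℕP.≤-total (toℕ i) (toℕ j)
  ... | inj₁ i≤j = ℤP.<⇒≱
    (0<j-i⇒i<j (subst (+ 0 <_) (eq (L p i) (L p j) (+ toℕ i) (+ toℕ j)) (i<j⇒0<j-i j-i<Δ)))
    (monotone-by-steps m ascent (proj₁ ∘ bounds-at) i≤j)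
    where
    eq : ∀ a b s t → (a - b) - (t - s) ≡ (a + s) - (b + t)
    eq = solve-∀
  ... | inj₂ j≤i = ℤP.<⇒≱
    (0<j-i⇒i<j (subst (+ 0 <_) (eq (L p i) (L p j) (+ toℕ i) (+ toℕ j)) (i<j⇒0<j-i i-j<Δ)))
    (monotone-by-steps m descent (proj₂ ∘ bounds-at) j≤i)
    where
    eq : ∀ a b s t → (a - b) - (s - t) ≡ (t - b) - (s - a)
    eq = solve-∀

OnPath : ∀ {m} → Path m → Sym → Set
OnPath {m} p P = Σ (Fin (suc m)) λ i → (L p i , toℕ i) ≡ P

private
  +d-t≤+[d∸t] : ∀ d t → + d - + t ≤ + (d ℕ.∸ t)
  +d-t≤+[d∸t] d t with ℕP.≤-total t d
  ... | inj₁ t≤d = ℤP.≤-reflexive (trans (ℤP.m-n≡m⊖n d t) (ℤP.⊖-≥ t≤d))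
  ... | inj₂ d≤t = ℤP.≤-trans (ℤP.≤-reflexive (trans (ℤP.m-n≡m⊖n d t) (ℤP.⊖-≤ d≤t)))
                              (ℤP.≤-trans ℤP.neg-≤-pos (+≤+ ℕ.z≤n))

  ∸-step : ∀ d t → (d ℕ.∸ suc t ≡ d ℕ.∸ t) ⊎ (suc (d ℕ.∸ suc t) ≡ d ℕ.∸ t)
  ∸-step zero t = inj₁ (trans (ℕP.0∸n≡0 (suc t)) (sym (ℕP.0∸n≡0 t)))
  ∸-step (suc d) zero = inj₂ refl
  ∸-step (suc d) (suc t) = ∸-step d t

  step-0-or-1 : ∀ a b → a - + 1 ≤ b → b ≤ a → (b ≡ a) ⊎ (b ≡ a - + 1)
  step-0-or-1 a b lo hi with compare₃ b a
  ... | inj₁ b≤a-1 = inj₂ (ℤP.≤-antisym b≤a-1 lo)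
  ... | inj₂ (inj₁ b≡a) = inj₁ b≡a
  ... | inj₂ (inj₂ a+1≤b) =
    ⊥-elim (ℤP.<-irrefl refl (ℤP.<-≤-trans (<-by (+ 1) (+<+ (ℕ.s≤s ℕ.z≤n)) refl)
                                           (ℤP.≤-trans a+1≤b hi)))

module _ {m : ℕ} .{{_ : NonZero m}} where
  open Inverse m

  private
    -- In ζ-coordinates u (with 2u = l + m + 1 − d) a path is a sequence that
    -- stays constant or drops by one at each step; V u d is the path
    -- l + ∣ t − d ∣ with vertex l_d.
    V : ℤ → ℕ → ℕ → ℤ
    V u d t = u + + (d ℕ.∸ t)

    V-step : ∀ u d t → (V u d t - + 1 ≤ V u d (suc t)) × (V u d (suc t) ≤ V u d t)
    V-step u d t with ∸-step d t
    ... | inj₁ eq =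
      ℤP.≤-trans (ℤP.i≤j⇒i-k≤j (+ 1) ℤP.≤-refl)
                 (ℤP.≤-reflexive (cong (λ z → u + + z) (sym eq))) ,
      ℤP.≤-reflexive (cong (λ z → u + + z) eq)
    ... | inj₂ eq =
      ℤP.≤-reflexive (sym V≡) ,
      ℤP.≤-trans (ℤP.≤-reflexive V≡) (ℤP.i≤j⇒i-k≤j (+ 1) ℤP.≤-refl)
      where
      V≡ : V u d (suc t) ≡ V u d t - + 1
      V≡ = trans (eq′ u (+ (d ℕ.∸ suc t))) (cong (λ z → u + + z - + 1) eq)
        where
        eq′ : ∀ u z → u + z ≡ u + (+ 1 + z) - + 1
        eq′ = solve-∀

    V-above : ∀ {l d u} t → + 2 * u ≡ l + s - + d → l ≤ + 2 * V u d t + + t - s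
    V-above {l} {d} {u} t 2u≡ = ≤-by (+ (d ℕ.∸ t) + (+ (d ℕ.∸ t) - (+ d - + t)))
      (ℤP.+-mono-≤ (+≤+ ℕ.z≤n) (ℤP.i≤j⇒0≤j-i (+d-t≤+[d∸t] d t))) (begin
        + 2 * (u + D) + + t - s          ≡⟨ eq₁ u D (+ t) s ⟩
        + 2 * u + + 2 * D + + t - s      ≡⟨ cong (λ z → z + + 2 * D + + t - s) 2u≡ ⟩
        (l + s - + d) + + 2 * D + + t - s ≡⟨ eq₂ l s (+ d) D (+ t) ⟩
        l + (D + (D - (+ d - + t)))      ∎)
      where
      open ≡-Reasoning
      D = + (d ℕ.∸ t)
      eq₁ : ∀ u D T s → + 2 * (u + D) + T - s ≡ + 2 * u + + 2 * D + T - s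
      eq₁ = solve-∀
      eq₂ : ∀ l s d D T → (l + s - d) + + 2 * D + T - s ≡ l + (D + (D - (d - T)))
      eq₂ = solve-∀

    V-vertex : ∀ u d → V u d d ≡ u
    V-vertex u d = trans (cong (λ z → u + + z) (ℕP.n∸n≡0 d)) (ℤP.+-identityʳ u)

    module Envelope (uP : ℤ) (dP : ℕ) (uQ : ℤ) (dQ : ℕ) where

      U : ℕ → ℤ
      U t = V uP dP t ⊓ V uQ dQ t

      Lℕ : ℕ → ℤ
      Lℕ t = + 2 * U t + + t - s

      Lℕ-step : ∀ t → (Lℕ (suc t) ≡ Lℕ t + + 1) ⊎ (Lℕ (suc t) ≡ Lℕ t - + 1)
      Lℕ-step t with step-0-or-1 (U t) (U (suc t))
        (ℤP.⊓-glb
          (ℤP.≤-trans (ℤP.+-monoˡ-≤ (ℤ.- + 1) (ℤP.i⊓j≤i VP VQ)) (proj₁ (V-step uP dP t)))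
          (ℤP.≤-trans (ℤP.+-monoˡ-≤ (ℤ.- + 1) (ℤP.i⊓j≤j VP VQ)) (proj₁ (V-step uQ dQ t))))
        (ℤP.⊓-mono-≤ (proj₂ (V-step uP dP t)) (proj₂ (V-step uQ dQ t)))
        where
        VP = V uP dP t
        VQ = V uQ dQ t
      ... | inj₁ U≡ = inj₁ (trans (cong (λ z → + 2 * z + + suc t - s) U≡) (eq (U t) (+ t) s))
        where
        eq : ∀ U T s → + 2 * U + (+ 1 + T) - s ≡ (+ 2 * U + T - s) + + 1
        eq = solve-∀
      ... | inj₂ U≡ = inj₂ (trans (cong (λ z → + 2 * z + + suc t - s) U≡) (eq (U t) (+ t) s))
        where
        eq : ∀ U T s → + 2 * (U - + 1) + (+ 1 + T) - s ≡ (+ 2 * U + T - s) - + 1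
        eq = solve-∀

      Lℕ-parity : ∀ t → (+ 2) ℤ∣.∣ (Lℕ t - + t - s)
      Lℕ-parity t = even⇒two∣ _ (U t - s) (eq (U t) (+ t) s)
        where
        eq : ∀ U T s → + 2 * U + T - s - T - s ≡ (U - s) * + 2
        eq = solve-∀

      Lℕ-at-P : uP ≤ V uQ dQ dP → Lℕ dP ≡ + 2 * uP + + dP - s
      Lℕ-at-P uP≤ = cong (λ z → + 2 * z + + dP - s)
        (trans (ℤP.i≤j⇒i⊓j≡i (subst (_≤ V uQ dQ dP) (sym (V-vertex uP dP)) uP≤)) (V-vertex uP dP))

      Lℕ-at-Q : uQ ≤ V uP dP dQ → Lℕ dQ ≡ + 2 * uQ + + dQ - s
      Lℕ-at-Q uQ≤ = cong (λ z → + 2 * z + + dQ - s)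
        (trans (ℤP.i≥j⇒i⊓j≡j (subst (_≤ V uP dP dQ) (sym (V-vertex uQ dQ)) uQ≤)) (V-vertex uQ dQ))

    V-path : ∀ {lP dP lQ dQ} → InE m (ℤ.- + 1) (lP , dP) → InE m (ℤ.- + 1) (lQ , dQ) →
             ζ-coord (lP , dP) ≤ ζ-coord (lQ , dQ) + + (dQ ℕ.∸ dP) →
             ζ-coord (lQ , dQ) ≤ ζ-coord (lP , dP) + + (dP ℕ.∸ dQ) →
             Σ (Path m) λ p → OnPath p (lP , dP) × OnPath p (lQ , dQ)
    V-path {lP} {dP} {lQ} {dQ} P∈E Q∈E uP≤ uQ≤ =
      path ,
      hits (proj₁ (proj₂ P∈E)) (trans (Lℕ-at-P uP≤) (2*ζ-coord+d P∈E)) ,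
      hits (proj₁ (proj₂ Q∈E)) (trans (Lℕ-at-Q uQ≤) (2*ζ-coord+d Q∈E))
      where
      open Envelope (ζ-coord (lP , dP)) dP (ζ-coord (lQ , dQ)) dQ

      Lℕ≥-1 : ∀ t → ℤ.- + 1 ≤ Lℕ t
      Lℕ≥-1 t with ℤP.⊓-sel (V (ζ-coord (lP , dP)) dP t) (V (ζ-coord (lQ , dQ)) dQ t)
      ... | inj₁ U≡ = ℤP.≤-trans (proj₁ P∈E)
        (subst (λ z → lP ≤ + 2 * z + + t - s) (sym U≡) (V-above t (2*ζ-coord P∈E)))
      ... | inj₂ U≡ = ℤP.≤-trans (proj₁ Q∈E)
        (subst (λ z → lQ ≤ + 2 * z + + t - s) (sym U≡) (V-above t (2*ζ-coord Q∈E)))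

      path : Path m
      path = record
        { L = Lℕ ∘ toℕ
        ; inE = λ j → Lℕ≥-1 (toℕ j) , ℕP.≤-pred (FinP.toℕ<n j) , Lℕ-parity (toℕ j)
        ; steps = λ j →
            subst (λ t → (Lℕ (suc (toℕ j)) ≡ Lℕ t + + 1) ⊎ (Lℕ (suc (toℕ j)) ≡ Lℕ t - + 1))
                  (sym (FinP.toℕ-inject₁ j)) (Lℕ-step (toℕ j))
        }

      hits : ∀ {l d} → d ℕ.≤ m → Lℕ d ≡ l → OnPath path (l , d)
      hits d≤m Lℕd≡l = fromℕ< (ℕ.s≤s d≤m) , cong₂ _,_ (trans (cong Lℕ column≡) Lℕd≡l) column≡
        where
        column≡ = FinP.toℕ-fromℕ< (ℕ.s≤s d≤m)

  module _ {lP dP lQ dQ} (P∈E : InE m (ℤ.- + 1) (lP , dP)) (Q∈E : InE m (ℤ.- + 1) (lQ , dQ)) where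

    private
      uP = ζ-coord (lP , dP)
      uQ = ζ-coord (lQ , dQ)
      Δl≡ : lP - lQ ≡ + 2 * (uP - uQ) + (+ dP - + dQ)
      Δl≡ = trans (cong₂ _-_ (sym (2*ζ-coord+d P∈E)) (sym (2*ζ-coord+d Q∈E)))
                  (eq uP uQ (+ dP) (+ dQ) s)
        where
        eq : ∀ a b c d s → (+ 2 * a + c - s) - (+ 2 * b + d - s) ≡ + 2 * (a - b) + (c - d)
        eq = solve-∀
      ≤+ℕ : ∀ {a b} {D : ℕ} → a ≤ b → a ≤ b + + D
      ≤+ℕ {b = b} {D} a≤b = ℤP.≤-trans a≤b (ℤP.i≤i+j b (+ D))
      ≤+∸ : ∀ {a b c d} → a + + c ≤ b + + d → a ≤ b + + (d ℕ.∸ c)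
      ≤+∸ {a} {b} {c} {d} le = ℤP.≤-trans
        (subst₂ _≤_ (eq₁ a (+ c)) (eq₂ b (+ d) (+ c)) (ℤP.+-monoˡ-≤ (ℤ.- + c) le))
        (ℤP.+-monoʳ-≤ b (+d-t≤+[d∸t] d c))
        where
        eq₁ : ∀ a c → a + c - c ≡ a
        eq₁ = solve-∀
        eq₂ : ∀ b d c → b + d - c ≡ b + (d - c)
        eq₂ = solve-∀

    -- With v = u + d the η-coordinate, P ⋗ Q means uQ < uP and vQ < vP.  When this
    -- fails, lQ ≤ lP puts each vertex weakly below the other V-shaped path, so the
    -- lower envelope of the two passes through both.
    common-path : lQ ≤ lP → ¬ ((lP , dP) ⋗ (lQ , dQ)) →
                  Σ (Path m) λ p → OnPath p (lP , dP) × OnPath p (lQ , dQ)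
    common-path lQ≤lP P⋗̸Q with uQ ℤP.<? uP | uQ + + dQ ℤP.<? uP + + dP
    ... | yes uQ<uP | yes vQ<vP =
      ⊥-elim (P⋗̸Q (to (cone-coordinate uP uQ ζ-gap) uQ<uP ,
                    to (cone-coordinate (uP + + dP) (uQ + + dQ) η-gap) vQ<vP))
      where
      eq₁ : ∀ a b c d → + 2 * (a - b) + (c - d) - (c - d) ≡ + 2 * (a - b)
      eq₁ = solve-∀
      eq₂ : ∀ a b c d → + 2 * (a - b) + (c - d) - (d - c) ≡ + 2 * ((a + c) - (b + d))
      eq₂ = solve-∀
      ζ-gap : lP - lQ - (+ dP - + dQ) ≡ + 2 * (uP - uQ)
      ζ-gap = trans (cong (_- (+ dP - + dQ)) Δl≡) (eq₁ uP uQ (+ dP) (+ dQ))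
      η-gap : lP - lQ - (+ dQ - + dP) ≡ + 2 * ((uP + + dP) - (uQ + + dQ))
      η-gap = trans (cong (_- (+ dQ - + dP)) Δl≡) (eq₂ uP uQ (+ dP) (+ dQ))
    ... | no uQ≮uP | _ = V-path P∈E Q∈E (≤+ℕ uP≤uQ) (≤+∸ {uQ} {uP} {dQ} {dP} vQ≤vP)
      where
      uP≤uQ = ℤP.≮⇒≥ uQ≮uP
      vQ≤vP : uQ + + dQ ≤ uP + + dP
      vQ≤vP = ℤP.0≤i-j⇒j≤i (subst (+ 0 ≤_) (trans (cong (_+ (uQ - uP)) Δl≡) (eq uP uQ (+ dP) (+ dQ)))
        (ℤP.+-mono-≤ (ℤP.i≤j⇒0≤j-i lQ≤lP) (ℤP.i≤j⇒0≤j-i uP≤uQ)))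
        where
        eq : ∀ a b c d → + 2 * (a - b) + (c - d) + (b - a) ≡ (a + c) - (b + d)
        eq = solve-∀
    ... | yes _ | no vQ≮vP = V-path P∈E Q∈E (≤+∸ {uP} {uQ} {dP} {dQ} vP≤vQ) (≤+ℕ uQ≤uP)
      where
      vP≤vQ = ℤP.≮⇒≥ vQ≮vP
      uQ≤uP : uQ ≤ uP
      uQ≤uP = ℤP.0≤i-j⇒j≤i
        (subst (+ 0 ≤_) (trans (cong (_+ ((uQ + + dQ) - (uP + + dP))) Δl≡) (eq uP uQ (+ dP) (+ dQ)))
          (ℤP.+-mono-≤ (ℤP.i≤j⇒0≤j-i lQ≤lP) (ℤP.i≤j⇒0≤j-i vP≤vQ)))
        where
        eq : ∀ a b c d → + 2 * (a - b) + (c - d) + ((b + d) - (a + c)) ≡ a - b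
        eq = solve-∀

module _ {A : Set} {R : A → A → Set} where

  AllPairs-++⁻ˡ : ∀ xs {ys} → AllPairs R (xs ++ ys) → AllPairs R xs
  AllPairs-++⁻ˡ [] _ = []
  AllPairs-++⁻ˡ (x ∷ xs) (Rx ∷ Rxs) = AllP.++⁻ˡ xs Rx ∷ AllPairs-++⁻ˡ xs Rxs

  AllPairs-∷ʳ⁻ : ∀ xs {w} → AllPairs R (xs ∷ʳ w) → All (λ x → R x w) xs
  AllPairs-∷ʳ⁻ [] _ = []
  AllPairs-∷ʳ⁻ (x ∷ xs) (Rx ∷ Rxs) = proj₂ (AllP.∷ʳ⁻ Rx) ∷ AllPairs-∷ʳ⁻ xs Rxs

  AllPairs-related : ∀ {xs a b} → AllPairs R xs → a ∈ xs → b ∈ xs → a ≢ b → R a b ⊎ R b a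
  AllPairs-related (_ ∷ _) (here refl) (here refl) a≢b = ⊥-elim (a≢b refl)
  AllPairs-related (Ra ∷ _) (here refl) (there b∈) _ = inj₁ (All.lookup Ra b∈)
  AllPairs-related (Rb ∷ _) (there a∈) (here refl) _ = inj₂ (All.lookup Rb a∈)
  AllPairs-related (_ ∷ Rxs) (there a∈) (there b∈) a≢b = AllPairs-related Rxs a∈ b∈ a≢b

count-here : ∀ u σ → count u (u ∷ σ) ≡ suc (count u σ)
count-here u σ = cong length (LP.filter-accept (_≟S u) {u} {σ} refl)

count-there : ∀ {u v} σ → v ≢ u → count u (v ∷ σ) ≡ count u σ
count-there {u} {v} σ v≢u = cong length (LP.filter-reject (_≟S u) {v} {σ} v≢u)

count-≤-∷ : ∀ u v σ → count u σ ℕ.≤ count u (v ∷ σ)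
count-≤-∷ u v σ = by-cases (v ≟S u)
  where
  by-cases : Dec (v ≡ u) → count u σ ℕ.≤ count u (v ∷ σ)
  by-cases (yes refl) = ℕP.≤-trans (ℕP.n≤1+n (count u σ)) (ℕP.≤-reflexive (sym (count-here u σ)))
  by-cases (no v≢u) = ℕP.≤-reflexive (sym (count-there σ v≢u))

count>0⇒∈ : ∀ u σ → 1 ℕ.≤ count u σ → u ∈ σ
count>0⇒∈ u (v ∷ σ) 1≤count = by-cases (v ≟S u)
  where
  by-cases : Dec (v ≡ u) → u ∈ v ∷ σ
  by-cases (yes refl) = here refl
  by-cases (no v≢u) = there (count>0⇒∈ u σ (subst (1 ℕ.≤_) (count-there σ v≢u) 1≤count))

count≤1 : ∀ u σ → AllPairs _⋗_ σ → count u σ ℕ.≤ 1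
count≤1 u [] _ = ℕ.z≤n
count≤1 u (v ∷ σ) (v⋗σ ∷ ⋗σ) = by-cases (v ≟S u)
  where
  by-cases : Dec (v ≡ u) → count u (v ∷ σ) ℕ.≤ 1
  by-cases (yes refl) = ℕP.≤-reflexive (trans (count-here v σ)
    (cong (suc ∘ length) (LP.filter-none (_≟S v) (All.map v⋗w⇒w≢v v⋗σ))))
    where
    v⋗w⇒w≢v : ∀ {w} → v ⋗ w → w ≢ v
    v⋗w⇒w≢v v⋗w refl = ⋗-irrefl {v} v⋗w
  by-cases (no v≢u) = subst (ℕ._≤ 1) (sym (count-there σ v≢u)) (count≤1 u σ ⋗σ)

sum-tabulate≡0 : ∀ {n} (g : Fin n → ℕ) → (∀ i → g i ≡ 0) → sumℕ (tabulate g) ≡ 0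
sum-tabulate≡0 {zero} g _ = refl
sum-tabulate≡0 {suc n} g g≡0 =
  cong₂ ℕ._+_ (g≡0 Fin.zero) (sum-tabulate≡0 (g ∘ Fin.suc) (g≡0 ∘ Fin.suc))

sum-tabulate≤1 : ∀ {n} (g : Fin n → ℕ) → (∀ i → g i ℕ.≤ 1) →
                 (∀ i j → 1 ℕ.≤ g i → 1 ℕ.≤ g j → i ≡ j) → sumℕ (tabulate g) ℕ.≤ 1
sum-tabulate≤1 {zero} g _ _ = ℕ.z≤n
sum-tabulate≤1 {suc n} g g≤1 unique with g Fin.zero in g₀≡
... | zero =
  sum-tabulate≤1 (g ∘ Fin.suc) (g≤1 ∘ Fin.suc) (λ i j p q → FinP.suc-injective (unique _ _ p q))
... | suc k = subst (λ z → suc k ℕ.+ z ℕ.≤ 1) (sym (sum-tabulate≡0 (g ∘ Fin.suc) rest≡0))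
                (subst (ℕ._≤ 1) (trans g₀≡ (sym (ℕP.+-identityʳ (suc k)))) (g≤1 Fin.zero))
  where
  rest≡0 : ∀ i → g (Fin.suc i) ≡ 0
  rest≡0 i with g (Fin.suc i) in gᵢ≡
  ... | zero = refl
  ... | suc _ with unique Fin.zero (Fin.suc i) (subst (1 ℕ.≤_) (sym g₀≡) (ℕ.s≤s ℕ.z≤n))
                                              (subst (1 ℕ.≤_) (sym gᵢ≡) (ℕ.s≤s ℕ.z≤n))
  ...   | ()

≤-sum-tabulate : ∀ {n} (g : Fin n → ℕ) i → g i ℕ.≤ sumℕ (tabulate g)
≤-sum-tabulate g Fin.zero = ℕP.m≤m+n _ _
≤-sum-tabulate g (Fin.suc i) = ℕP.≤-trans (≤-sum-tabulate (g ∘ Fin.suc) i) (ℕP.m≤n+m _ _)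

+≤-sum-tabulate : ∀ {n} (g : Fin n → ℕ) i j → i ≢ j → g i ℕ.+ g j ℕ.≤ sumℕ (tabulate g)
+≤-sum-tabulate g Fin.zero Fin.zero i≢j = ⊥-elim (i≢j refl)
+≤-sum-tabulate g Fin.zero (Fin.suc j) _ = ℕP.+-monoʳ-≤ (g Fin.zero) (≤-sum-tabulate (g ∘ Fin.suc) j)
+≤-sum-tabulate g (Fin.suc i) Fin.zero _ =
  subst (ℕ._≤ sumℕ (tabulate g)) (ℕP.+-comm (g Fin.zero) (g (Fin.suc i)))
    (ℕP.+-monoʳ-≤ (g Fin.zero) (≤-sum-tabulate (g ∘ Fin.suc) i))
+≤-sum-tabulate g (Fin.suc i) (Fin.suc j) i≢j =
  ℕP.≤-trans (+≤-sum-tabulate (g ∘ Fin.suc) i j (i≢j ∘ cong Fin.suc)) (ℕP.m≤n+m _ _)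

sum-map-allFin : ∀ n (g : Fin n → ℕ) → sumℕ (map g (allFin n)) ≡ sumℕ (tabulate g)
sum-map-allFin n g = cong sumℕ (LP.map-tabulate (λ i → i) g)

module _ {m : ℕ} where

  Dominates-trans : ∀ {a b c} → Dominates m a b → Dominates m b c → Dominates m a c
  Dominates-trans (ζ< , η<) (ζ<′ , η<′) = ℤP.<-trans ζ<′ ζ< , ℤP.<-trans η<′ η<

  Dominates⇒size+2≤ : ∀ {a b} → Dominates m a b → proj₁ (𝟙 m b) + + 2 ≤ proj₁ (𝟙 m a)
  Dominates⇒size+2≤ {a} {b} (ζ< , η<) = subst₂ _≤_
    (trans (eq (η-rank m b) (ζ-rank m b) (+ suc m)) (cong (_+ + 2) (sym (size-𝟙 m b))))
    (sym (size-𝟙 m a))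
    (ℤP.+-monoˡ-≤ (ℤ.- + suc m) (ℤP.+-mono-≤ (i<j⇒i+1≤j η<) (i<j⇒i+1≤j ζ<)))
    where
    eq : ∀ η ζ s → (η + + 1) + (ζ + + 1) - s ≡ (η + ζ - s) + + 2
    eq = solve-∀

  ≫-chain⇒⋗-chain : ∀ {xs} → All (ValidSC m) xs → Linked _≫_ xs →
                     Linked (Dominates m) xs × Linked _⋗_ (map (𝟙 m) xs)
  ≫-chain⇒⋗-chain _ [] = [] , []
  ≫-chain⇒⋗-chain _ [-] = [-] , [-]
  ≫-chain⇒⋗-chain {a ∷ b ∷ _} (va ∷ vb ∷ vs) (a≫b ∷ chain) =
    dom ∷ proj₁ rest , to (Dominates⇔𝟙⋗𝟙 {m} {a} {b} va vb) dom ∷ proj₂ rest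
    where
    dom = to (≫⇔Dominates {m} {a} {b} va vb) a≫b
    rest = ≫-chain⇒⋗-chain (vb ∷ vs) chain

  module _ .{{_ : NonZero m}} where
    open Inverse m

    ⋗-chain⇒≫-chain : ∀ {Ps} → All (InE m (ℤ.- + 1)) Ps → Linked _⋗_ Ps →
                       Linked _≫_ (map 𝟙⁻¹ Ps)
    ⋗-chain⇒≫-chain _ [] = []
    ⋗-chain⇒≫-chain _ [-] = [-]
    ⋗-chain⇒≫-chain {P ∷ Q ∷ _} (P∈E ∷ Q∈E ∷ Es) (P⋗Q ∷ chain) =
      from (≫⇔Dominates {m} {𝟙⁻¹ P} {𝟙⁻¹ Q} (𝟙⁻¹-valid P∈E) (𝟙⁻¹-valid Q∈E))
        (from (Dominates⇔𝟙⋗𝟙 {m} {𝟙⁻¹ P} {𝟙⁻¹ Q} (𝟙⁻¹-valid P∈E) (𝟙⁻¹-valid Q∈E))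
          (subst₂ _⋗_ (sym (𝟙∘𝟙⁻¹ P∈E)) (sym (𝟙∘𝟙⁻¹ Q∈E)) P⋗Q))
      ∷ ⋗-chain⇒≫-chain (Q∈E ∷ Es) chain

module Bijection (m : ℕ) .{{_ : NonZero m}} (ω : SC) (ω-spec : ΩSpec m ω) where
  open Inverse m
  open ΩSpec ω-spec

  w : Sym
  w = 𝟙 m ω

  private
    w∉E₁ : ¬ (+ 1 ≤ proj₁ w)
    w∉E₁ 1≤w = ℤP.<-irrefl refl (ℤP.<-≤-trans size-𝟙ω<1 1≤w)

    w∈E : InE m (ℤ.- + 1) w
    w∈E = 𝟙∈E ω ω-valid size-𝟙ω≥-1

    E₁⊆E : ∀ {P} → InE m (+ 1) P → InE m (ℤ.- + 1) P
    E₁⊆E (1≤l , d≤m , parity) = ℤP.≤-trans -≤+ 1≤l , d≤m , parity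

    χ-does⇒ : ∀ {A : Set} (a? : Dec A) → 1 ℕ.≤ χ (does a?) → A
    χ-does⇒ (yes a) _ = a

  freq-E₁ : ∀ σ u → + 1 ≤ proj₁ u → freq m ω σ u ≡ count u σ
  freq-E₁ σ u 1≤l with (+ 1) ℤP.≤? proj₁ u
  ... | yes _ = refl
  ... | no 1≰l = ⊥-elim (1≰l 1≤l)

  freq-w : ∀ σ → freq m ω σ w ≡ 1
  freq-w σ with (+ 1) ℤP.≤? proj₁ w
  ... | yes 1≤w = ⊥-elim (w∉E₁ 1≤w)
  ... | no _ with w ≟S w
  ...   | yes _ = refl
  ...   | no w≢w = ⊥-elim (w≢w refl)

  freq≤1 : ∀ σ u → AllPairs _⋗_ σ → freq m ω σ u ℕ.≤ 1
  freq≤1 σ u ⋗σ with (+ 1) ℤP.≤? proj₁ u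
  ... | yes _ = count≤1 u σ ⋗σ
  ... | no _ with does (u ≟S w)
  ...   | true = ℕP.≤-refl
  ...   | false = ℕ.z≤n

  freq>0⇒∈ : ∀ σ u → 1 ℕ.≤ freq m ω σ u → u ∈ σ ∷ʳ w
  freq>0⇒∈ σ u 1≤f with (+ 1) ℤP.≤? proj₁ u
  ... | yes _ = AnyP.++⁺ˡ (count>0⇒∈ u σ 1≤f)
  ... | no _ = subst (_∈ σ ∷ʳ w) (sym (χ-does⇒ (u ≟S w) 1≤f)) (AnyP.++⁺ʳ σ (here refl))

  module _ {π : List SC} (π-valid : All (ValidSC m) π) (chain : Linked _≫_ (π ∷ʳ ω)) where

    private
      σ = map (𝟙 m) π

      chains = ≫-chain⇒⋗-chain (AllP.++⁺ π-valid (ω-valid ∷ [])) chain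

      ⋗-pairs : AllPairs _⋗_ (σ ∷ʳ w)
      ⋗-pairs = Linked⇒AllPairs (λ {P} {Q} {R} → ⋗-trans {P} {Q} {R})
        (subst (Linked _⋗_) (LP.map-++ (𝟙 m) π (ω ∷ [])) (proj₂ chains))

      ⋗-pairsσ : AllPairs _⋗_ σ
      ⋗-pairsσ = AllPairs-++⁻ˡ σ ⋗-pairs

      1≤size : ∀ e → Dominates m e ω → + 1 ≤ proj₁ (𝟙 m e)
      1≤size e e≻ω =
        ℤP.≤-trans (ℤP.+-monoˡ-≤ (+ 2) size-𝟙ω≥-1) (Dominates⇒size+2≤ {m} {e} {ω} e≻ω)

    𝟙-parts∈E₁ : All (InE m (+ 1)) σ
    𝟙-parts∈E₁ = AllP.map⁺ (All.zipWith (λ { {e} (ve , e≻ω) → 𝟙∈E e ve (1≤size e e≻ω) })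
      (π-valid , AllPairs-∷ʳ⁻ π
        (Linked⇒AllPairs (λ {a} {b} {c} → Dominates-trans {m} {a} {b} {c}) (proj₁ chains))))

    𝟙-parts-sorted : Linked _≽_ σ
    𝟙-parts-sorted =
      Linked.map (λ {P} {Q} P⋗Q → inj₁ (⋗⇒size> {P} {Q} P⋗Q)) (AllPairs⇒Linked ⋗-pairsσ)

    𝟙-parts-path-condition : PathCond m ω σ
    𝟙-parts-path-condition p = subst (ℕ._≤ 1) (sym (sum-map-allFin (suc m) g))
      (sum-tabulate≤1 g (λ i → freq≤1 σ (L p i , toℕ i) ⋗-pairsσ) unique)
      where
      g : Fin (suc m) → ℕ
      g i = freq m ω σ (L p i , toℕ i)
      unique : ∀ i j → 1 ℕ.≤ g i → 1 ℕ.≤ g j → i ≡ j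
      unique i j 1≤gi 1≤gj with i FinP.≟ j
      ... | yes i≡j = i≡j
      ... | no i≢j
        with AllPairs-related ⋗-pairs (freq>0⇒∈ σ (L p i , toℕ i) 1≤gi)
                                      (freq>0⇒∈ σ (L p j , toℕ j) 1≤gj)
                                      (i≢j ∘ FinP.toℕ-injective ∘ cong proj₂)
      ...   | inj₁ i⋗j = ⊥-elim (path-antichain p i j i⋗j)
      ...   | inj₂ j⋗i = ⊥-elim (path-antichain p j i j⋗i)

    size-𝟙-parts : sizeP σ ≡ weight𝟙 m π
    size-𝟙-parts = cong sumℤ (sym (LP.map-∘ π))

  module _ {σ : List Sym} (σ∈E₁ : All (InE m (+ 1)) σ) (sorted : Linked _≽_ σ)
           (path-condition : PathCond m ω σ) where

    private
      f : Sym → ℕ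
      f = freq m ω σ

      -- If P ⋗ Q failed, a common path through P and Q would carry total frequency at least 2.
      ⋗-forced : ∀ {P Q} → InE m (ℤ.- + 1) P → InE m (ℤ.- + 1) Q → proj₁ Q ≤ proj₁ P →
                 1 ℕ.≤ f P → 1 ℕ.≤ f Q → (P ≡ Q → 2 ℕ.≤ f P) → P ⋗ Q
      ⋗-forced {P} {Q} P∈E Q∈E Q≤P 1≤fP 1≤fQ 2≤fP with P ⋗? Q
      ... | yes P⋗Q = P⋗Q
      ... | no P⋗̸Q with common-path P∈E Q∈E Q≤P P⋗̸Q
      ...   | p , (i , i≡P) , (j , j≡Q) =
        ⊥-elim (ℕP.<-irrefl refl (ℕP.<-≤-trans 2≤sum (path-condition p)))
        where
        g : Fin (suc m) → ℕ
        g k = f (L p k , toℕ k)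
        2≤sum : 2 ℕ.≤ sumℕ (map g (allFin (suc m)))
        2≤sum with P ≟S Q
        ... | yes P≡Q = subst (2 ℕ.≤_) (sym (sum-map-allFin (suc m) g))
              (ℕP.≤-trans (subst (2 ℕ.≤_) (cong f (sym i≡P)) (2≤fP P≡Q)) (≤-sum-tabulate g i))
        ... | no P≢Q = subst (2 ℕ.≤_) (sym (sum-map-allFin (suc m) g))
              (ℕP.≤-trans (ℕP.+-mono-≤ (subst (1 ℕ.≤_) (cong f (sym i≡P)) 1≤fP)
                                       (subst (1 ℕ.≤_) (cong f (sym j≡Q)) 1≤fQ))
                          (+≤-sum-tabulate g i j (λ { refl → P≢Q (trans (sym i≡P) j≡Q) })))

      Suffix : List Sym → Set
      Suffix ys = ∀ u → count u ys ℕ.≤ count u σ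

      1≤f-head : ∀ {p ys} → Suffix (p ∷ ys) → + 1 ≤ proj₁ p → 1 ℕ.≤ f p
      1≤f-head {p} {ys} suffix 1≤l = subst (1 ℕ.≤_) (sym (freq-E₁ σ p 1≤l))
        (ℕP.≤-trans (subst (1 ℕ.≤_) (sym (count-here p ys)) (ℕ.s≤s ℕ.z≤n)) (suffix p))

      ⋗-chain : ∀ ys → Suffix ys → All (InE m (+ 1)) ys → Linked _≽_ ys → Linked _⋗_ (ys ∷ʳ w)
      ⋗-chain [] _ _ _ = [-]
      ⋗-chain (p ∷ []) suffix (p∈E₁ ∷ []) _ =
        ⋗-forced (E₁⊆E p∈E₁) w∈E (ℤP.≤-trans (ℤP.<⇒≤ size-𝟙ω<1) (proj₁ p∈E₁))
          (1≤f-head suffix (proj₁ p∈E₁)) (ℕP.≤-reflexive (sym (freq-w σ)))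
          (λ { refl → ⊥-elim (w∉E₁ (proj₁ p∈E₁)) })
        ∷ [-]
      ⋗-chain (p ∷ q ∷ ys) suffix (p∈E₁ ∷ q∈E₁ ∷ ys∈E₁) (p≽q ∷ sorted′) =
        ⋗-forced (E₁⊆E p∈E₁) (E₁⊆E q∈E₁) (≽⇒size≥ p≽q)
          (1≤f-head suffix (proj₁ p∈E₁)) (1≤f-head suffix′ (proj₁ q∈E₁)) repeated
        ∷ ⋗-chain (q ∷ ys) suffix′ (q∈E₁ ∷ ys∈E₁) sorted′
        where
        suffix′ : Suffix (q ∷ ys)
        suffix′ u = ℕP.≤-trans (count-≤-∷ u p (q ∷ ys)) (suffix u)
        ≽⇒size≥ : p ≽ q → proj₁ q ≤ proj₁ p
        ≽⇒size≥ (inj₁ q<p) = ℤP.<⇒≤ q<p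
        ≽⇒size≥ (inj₂ (p≡q , _)) = ℤP.≤-reflexive (sym p≡q)
        repeated : p ≡ q → 2 ℕ.≤ f p
        repeated refl = subst (2 ℕ.≤_) (sym (freq-E₁ σ p (proj₁ p∈E₁)))
          (ℕP.≤-trans (subst (2 ℕ.≤_) (sym (trans (count-here p (p ∷ ys)) (cong suc (count-here p ys))))
                                      (ℕ.s≤s (ℕ.s≤s ℕ.z≤n)))
                      (suffix p))

    𝟙⁻¹-chain : Linked _≫_ (map 𝟙⁻¹ σ ∷ʳ ω)
    𝟙⁻¹-chain = subst (Linked _≫_)
      (trans (LP.map-++ 𝟙⁻¹ σ (w ∷ []))
             (cong (λ e → map 𝟙⁻¹ σ ∷ʳ e) (𝟙⁻¹∘𝟙 ω ω-valid)))
      (⋗-chain⇒≫-chain (AllP.++⁺ (All.map E₁⊆E σ∈E₁) (w∈E ∷ []))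
                        (⋗-chain σ (λ _ → ℕP.≤-refl) σ∈E₁ sorted))

  module _ {σ : List Sym} (σ∈E₁ : All (InE m (+ 1)) σ) where

    𝟙⁻¹-parts-valid : All (ValidSC m) (map 𝟙⁻¹ σ)
    𝟙⁻¹-parts-valid = AllP.map⁺ (All.map (λ P∈E₁ → 𝟙⁻¹-valid (E₁⊆E P∈E₁)) σ∈E₁)

    map-𝟙∘𝟙⁻¹ : map (𝟙 m) (map 𝟙⁻¹ σ) ≡ σ
    map-𝟙∘𝟙⁻¹ =
      trans (sym (LP.map-∘ σ))
            (LP.map-id-local (All.map (λ P∈E₁ → 𝟙∘𝟙⁻¹ (E₁⊆E P∈E₁)) σ∈E₁))

    weight-𝟙⁻¹-parts : weight𝟙 m (map 𝟙⁻¹ σ) ≡ sizeP σ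
    weight-𝟙⁻¹-parts =
      trans (cong sumℤ (LP.map-∘ (map 𝟙⁻¹ σ))) (cong (sumℤ ∘ map proj₁) map-𝟙∘𝟙⁻¹)

  map-𝟙⁻¹∘𝟙 : ∀ {π} → All (ValidSC m) π → map 𝟙⁻¹ (map (𝟙 m) π) ≡ π
  map-𝟙⁻¹∘𝟙 {π} π-valid =
    trans (sym (LP.map-∘ π)) (LP.map-id-local (All.map (λ {e} → 𝟙⁻¹∘𝟙 e) π-valid))

  -- Refinement proofs are irrelevant, so the inverse laws recompute them by decision.
  private
    ValidSC? : ∀ e → Dec (ValidSC m e)
    ValidSC? e = (1 ℕP.≤? x e) ×-dec (x e ℕP.≤? y e) ×-dec (y e ℕP.≤? m)

    InE₁? : ∀ P → Dec (InE m (+ 1) P)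
    InE₁? (l , d) = ((+ 1) ℤP.≤? l) ×-dec (d ℕP.≤? m) ×-dec (2 ℕ∣.∣? ∣ l - + d - + suc m ∣)

  bijection : ∀ n → LHS m ω n ↔ RHS m ω n
  bijection n = mk↔ₛ′ toRHS toLHS toRHS∘toLHS toLHS∘toRHS
    where
    toRHS : LHS m ω n → RHS m ω n
    toRHS (σ , proof) = map 𝟙⁻¹ σ , Irr.map (λ { ((σ∈E₁ , sorted , condition) , size≡) →
      (𝟙⁻¹-parts-valid σ∈E₁ , 𝟙⁻¹-chain σ∈E₁ sorted condition) ,
      trans (weight-𝟙⁻¹-parts σ∈E₁) size≡ }) proof

    toLHS : RHS m ω n → LHS m ω n
    toLHS (π , proof) = map (𝟙 m) π , Irr.map (λ { ((π-valid , chain) , weight≡) →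
      (𝟙-parts∈E₁ π-valid chain , 𝟙-parts-sorted π-valid chain ,
       𝟙-parts-path-condition π-valid chain) ,
      trans (size-𝟙-parts π-valid chain) weight≡ }) proof

    toRHS∘toLHS : ∀ π → toRHS (toLHS π) ≡ π
    toRHS∘toLHS (π , [ proof ]) =
      value-injective (map-𝟙⁻¹∘𝟙 (recompute (All.all? ValidSC? π) (proj₁ (proj₁ proof))))

    toLHS∘toRHS : ∀ σ → toLHS (toRHS σ) ≡ σ
    toLHS∘toRHS (σ , [ proof ]) =
      value-injective (map-𝟙∘𝟙⁻¹ (recompute (All.all? InE₁? σ) (proj₁ (proj₁ proof))))

theorem5p12 : (m : ℕ) → 1 ℕ.≤ m → (ω : SC) → InΩ m ω → (n : ℤ) → LHS m ω n ↔ RHS m ω n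
theorem5p12 zero () _ _
theorem5p12 (suc m) 1≤m ω ω∈Ω = Bijection.bijection (suc m) ω (Ω-spec 1≤m ω∈Ω)
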